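{- Let $s>2$ and $t>3$ be integers. In the wall $W_{s,t}$ let $F_1=\{v_{i,j}\mid i\in[s+1], j\in[2]\}\cup\{u_{i,2}\mid i\in[s+1]\}\cup\{v_{i,t},u_{i,t}\mid i\in[s+1]\}\cup\{v_{i,t+1}\mid i\in[s+1]$, if $t$ is odd$\}\cup\{u_{i,t+1}\mid i\in[s+1]$, if $t$ is even$\}$ and $F_2=\{v_{1,j},u_{1,j},v_{2,j}\mid 3\le j<t\}\cup\{u_{s,j},v_{s+1,j},u_{s+1,j}\mid 3\le j<t\}$. Then $F=F_1\cup F_2$ is a frame for $W_{s,t}$.
   Context: Wall $W_{s,t}$ (width $s$, height $t$): vertices $v_{i,j}$ ($i\in[s+1]$, $j\in[t]$); $v_{i,t+1}$ ($i\in[s+1]$) if $t$ odd; $u_{i,j}$ ($i\in[s+1]$, $2\le j\le t$); $u_{i,t+1}$ ($i\in[s+1]$) if $t$ even. Edges: $v_{i,1}v_{i+1,1}$ ($i\in[s]$); $v_{i,t+1}v_{i+1,t+1}$ ($i\in[s]$) if $t$ odd; $u_{i,t+1}u_{i+1,t+1}$ ($i\in[s]$) if $t$ even; $v_{i,j}u_{i,j}$ ($i\in[s+1]$, $2\le j\le t$); $u_{i,j}v_{i+1,j}$ ($i\in[s]$, $2\le j\le t$); $v_{i,j}v_{i,j+1}$ ($i\in[s+1]$, odd $j\in[t]$); $u_{i,j}u_{i,j+1}$ ($i\in[s+1]$, even $j\in[t]$). An endomorphism of a graph $G$ is a map $h:V(G)\to V(G)$ with $h(u)h(v)\in E(G)$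 for all $uv\in E(G)$. A set $F\subseteq V(G)$ is a frame for $G$ if every endomorphism $h$ of $G$ with $F\subseteq h(V(G))$ is surjective. -}

module Defs where

open import Data.Nat using (ℕ; zero; suc; _+_; _≤_; _<_; _%_)
open import Data.Product using (Σ; ∃; _×_; proj₁)
open import Data.Sum using (_⊎_)
open import Relation.Binary.PropositionalEquality using (_≡_)

-- Raw vertex names of a wall: v i j stands for v_{i,j}, u i j for u_{i,j} (1-indexed).
data Raw : Set where
  v : ℕ → ℕ → Raw
  u : ℕ → ℕ → Raw

Odd Even : ℕ → Set
Odd n = n % 2 ≡ 1
Even n = n % 2 ≡ 0

_∈[_] : ℕ → ℕ → Set
i ∈[ n ] = 1 ≤ i × i ≤ n

IsVertex : ℕ → ℕ → Raw → Set
IsVertex s t (v i j) = i ∈[ suc s ] × (j ∈[ t ] ⊎ (Odd t × j ≡ suc t))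
IsVertex s t (u i j) = i ∈[ suc s ] × ((2 ≤ j × j ≤ t) ⊎ (Even t × j ≡ suc t))

Vertex : ℕ → ℕ → Set
Vertex s t = Σ Raw (IsVertex s t)

-- Edges of W_{s,t}, listed with one orientation
data Edge (s t : ℕ) : Raw → Raw → Set where
  bottom : ∀ {i} → i ∈[ s ] → Edge s t (v i 1) (v (suc i) 1)
  topV   : ∀ {i} → Odd t → i ∈[ s ] → Edge s t (v i (suc t)) (v (suc i) (suc t))
  topU   : ∀ {i} → Even t → i ∈[ s ] → Edge s t (u i (suc t)) (u (suc i) (suc t))
  vu     : ∀ {i j} → i ∈[ suc s ] → 2 ≤ j → j ≤ t → Edge s t (v i j) (u i j)
  uv     : ∀ {i j} → i ∈[ s ] → 2 ≤ j → j ≤ t → Edge s t (u i j) (v (suc i) j)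
  vv     : ∀ {i j} → i ∈[ suc s ] → Odd j → j ∈[ t ] → Edge s t (v i j) (v i (suc j))
  uu     : ∀ {i j} → i ∈[ suc s ] → Even j → j ∈[ t ] → Edge s t (u i j) (u i (suc j))

Adj : ℕ → ℕ → Raw → Raw → Set
Adj s t x y = Edge s t x y ⊎ Edge s t y x

IsEndomorphism : (s t : ℕ) → (Vertex s t → Vertex s t) → Set
IsEndomorphism s t h = ∀ (x y : Vertex s t) →
  Adj s t (proj₁ x) (proj₁ y) → Adj s t (proj₁ (h x)) (proj₁ (h y))

Surjective : ∀ {A B : Set} → (A → B) → Set
Surjective {A} {B} f = ∀ (b : B) → ∃ λ (a : A) → f a ≡ b

IsFrame : (s t : ℕ) → (Raw → Set) → Set
IsFrame s t F = ∀ (h : Vertex s t → Vertex s t) → IsEndomorphism s t h →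
  (∀ (x : Vertex s t) → F (proj₁ x) → ∃ λ y → h y ≡ x) →
  Surjective h

F₁ : ℕ → ℕ → Raw → Set
F₁ s t (v i j) = i ∈[ suc s ] × (j ∈[ 2 ] ⊎ j ≡ t ⊎ (Odd t × j ≡ suc t))
F₁ s t (u i j) = i ∈[ suc s ] × (j ≡ 2 ⊎ j ≡ t ⊎ (Even t × j ≡ suc t))

F₂ : ℕ → ℕ → Raw → Set
F₂ s t (v i j) = (3 ≤ j × j < t) × (i ≡ 1 ⊎ i ≡ 2 ⊎ i ≡ suc s)
F₂ s t (u i j) = (3 ≤ j × j < t) × (i ≡ 1 ⊎ i ≡ s ⊎ i ≡ suc s)

F : ℕ → ℕ → Raw → Set
F s t x = F₁ s t x ⊎ F₂ s t x

-- Give the vertices of row j the levels 2j and 2j+1 so that the edges of W_{s,t} become the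
-- steps of the path 3, 4, …, 2t+2 with a loop at each end; then level ∘ h is such a map as well.
-- Rows 1, 2 and rows t, t+1 are ladders of pentagons, and an odd cycle must use a loop, so along
-- each ladder level ∘ h stays within 2 of one end, the same end along the whole ladder. If both
-- ladders go to the same end, the vertex of F at the other end (v_{1,1} or row t+1) is missed.
-- Otherwise, after possibly reflecting the levels, bounds spread from the two ladders through
-- the middle rows and force level ∘ h = level there, so h permutes the rows 3, …, t−1 and moves
-- by single steps along each of them. The vertices of F₂ at both ends of a middle row have
-- preimages in the corresponding row, and the discrete intermediate value theorem fills in the
-- columns between them, which are all vertices outside F.
module Submission where

open import Defs
open import Data.Nat using (ℕ; zero; suc; _+_; _∸_; _≤_; _<_; _%_; z≤n; s≤s; pred; ⌊_/2⌋; _≟_; _≤?_)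
open import Data.Nat.Properties
open import Data.Nat.Tactic.RingSolver using (solve-∀)
open import Data.Bool using (Bool; true; false; not; if_then_else_)
open import Data.Bool.Properties using (not-involutive; not-¬)
open import Data.Product using (Σ; ∃; ∃₂; _×_; _,_; proj₁; proj₂)
open import Data.Sum using (_⊎_; inj₁; inj₂)
open import Data.Empty using (⊥; ⊥-elim)
open import Function using (_∘_; id)
open import Relation.Binary.PropositionalEquality
open import Relation.Nullary using (¬_; Dec; yes; no; contradiction)
open import Relation.Nullary.Decidable using (_×-dec_; _⊎-dec_)

even : ℕ → Bool
even zero = true
even (suc zero) = false
even (suc (suc n)) = even n

even-suc : ∀ n → even (suc n) ≡ not (even n)
even-suc zero = refl
even-suc (suc zero) = refl
even-suc (suc (suc n)) = even-suc n

even-pred : ∀ n → even n ≡ not (even (suc n))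
even-pred n = sym (trans (cong not (even-suc n)) (not-involutive (even n)))

even-double : ∀ n → even (n + n) ≡ true
even-double zero = refl
even-double (suc n) rewrite +-suc n n = even-double n

even⇒Even : ∀ n → even n ≡ true → Even n
even⇒Even zero _ = refl
even⇒Even (suc (suc n)) e = even⇒Even n e

odd⇒Odd : ∀ n → even n ≡ false → Odd n
odd⇒Odd (suc zero) _ = refl
odd⇒Odd (suc (suc n)) e = odd⇒Odd n e

Even⇒even : ∀ n → Even n → even n ≡ true
Even⇒even zero _ = refl
Even⇒even (suc (suc n)) e = Even⇒even n e

Odd⇒odd : ∀ n → Odd n → even n ≡ false
Odd⇒odd (suc zero) _ = refl
Odd⇒odd (suc (suc n)) e = Odd⇒odd n e

odd⇒1≤n : ∀ {n} → even n ≡ false → 1 ≤ n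
odd⇒1≤n {suc n} _ = s≤s z≤n

⌊1+n+n/2⌋≡n : ∀ n → ⌊ suc (n + n) /2⌋ ≡ n
⌊1+n+n/2⌋≡n n = sym (n≡⌈n+n/2⌉ n)

same-or-opposite : ∀ (a b : Bool) → a ≡ b ⊎ a ≡ not b
same-or-opposite true true = inj₁ refl
same-or-opposite true false = inj₂ refl
same-or-opposite false true = inj₂ refl
same-or-opposite false false = inj₁ refl

⌊1+n/2⌋-even : ∀ n → even n ≡ true → ⌊ suc n /2⌋ ≡ ⌊ n /2⌋
⌊1+n/2⌋-even zero _ = refl
⌊1+n/2⌋-even (suc (suc n)) e = cong suc (⌊1+n/2⌋-even n e)

⌊1+n/2⌋-odd : ∀ n → even n ≡ false → ⌊ suc n /2⌋ ≡ suc ⌊ n /2⌋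
⌊1+n/2⌋-odd (suc zero) _ = refl
⌊1+n/2⌋-odd (suc (suc n)) e = cong suc (⌊1+n/2⌋-odd n e)

1≤⌊n/2⌋ : ∀ {n} → even n ≡ true → 1 ≤ n → 1 ≤ ⌊ n /2⌋
1≤⌊n/2⌋ {suc (suc n)} _ _ = s≤s z≤n

⌊n/2⌋≤m : ∀ {n m} → n ≤ m + m → ⌊ n /2⌋ ≤ m
⌊n/2⌋≤m {m = m} le = subst (_ ≤_) (sym (n≡⌊n+n/2⌋ m)) (⌊n/2⌋-mono le)

⌊n/2⌋<m : ∀ {n m} → n < m + m → ⌊ n /2⌋ < m
⌊n/2⌋<m {n} {suc m} (s≤s le) =
  s≤s (subst (⌊ n /2⌋ ≤_) (sym (n≡⌈n+n/2⌉ m)) (⌊n/2⌋-mono (subst (n ≤_) (+-suc m m) le)))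

odd⇒≢double : ∀ {n} m → even n ≡ false → n ≢ m + m
odd⇒≢double m e refl = not-¬ (even-double m) e

LoopLevel : ℕ → ℕ → Set
LoopLevel t m = m ≡ 3 ⊎ m ≡ suc t + suc t

-- The edges of W_{s,t} as seen through level: the path 3, 4, …, 2t+2 with a loop at each end.
data LevelStep (t : ℕ) : ℕ → ℕ → Set where
  up   : ∀ {m} → LevelStep t m (suc m)
  down : ∀ {m} → LevelStep t (suc m) m
  loop : ∀ {m} → LoopLevel t m → LevelStep t m m

LevelStep-sym : ∀ {t m n} → LevelStep t m n → LevelStep t n m
LevelStep-sym up = down
LevelStep-sym down = up
LevelStep-sym (loop l) = loop l

Near : ℕ → ℕ → Set
Near m n = m ≤ suc n × n ≤ suc m

Near₂ : ℕ → ℕ → Set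
Near₂ m n = m ≤ 2 + n × n ≤ 2 + m

Near-sym : ∀ {m n} → Near m n → Near n m
Near-sym (m≤ , n≤) = n≤ , m≤

Near⇒Near₂ : ∀ {m n} → Near m n → Near₂ m n
Near⇒Near₂ (m≤ , n≤) = m≤n⇒m≤1+n m≤ , m≤n⇒m≤1+n n≤

Near∘Near⇒Near₂ : ∀ {a b c} → Near a b → Near b c → Near₂ a c
Near∘Near⇒Near₂ (a≤ , b≤a) (b≤c , c≤) = ≤-trans a≤ (s≤s b≤c) , ≤-trans c≤ (s≤s b≤a)

LevelStep⇒Near : ∀ {t m n} → LevelStep t m n → Near m n
LevelStep⇒Near {m = m} up = m≤n⇒m≤1+n (n≤1+n m) , ≤-refl
LevelStep⇒Near {n = n} down = ≤-refl , m≤n⇒m≤1+n (n≤1+n n)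
LevelStep⇒Near {m = m} (loop _) = n≤1+n m , n≤1+n m

-- Within distance 2 of a loop level.
NearLoop : ℕ → ℕ → Set
NearLoop t n = n ≤ 5 ⊎ t + t ≤ n

Near₂-LoopLevel : ∀ {t n m} → Near₂ n m → LoopLevel t m → NearLoop t n
Near₂-LoopLevel (n≤ , _) (inj₁ refl) = inj₁ n≤
Near₂-LoopLevel {t} {n} (_ , m≤) (inj₂ refl) =
  inj₂ (≤-pred (≤-pred (subst (_≤ 2 + n) (+-suc (suc t) t) m≤)))

parity-flip-or-loop : ∀ {t m n} → LevelStep t m n → even n ≡ not (even m) ⊎ LoopLevel t m
parity-flip-or-loop {m = m} up = inj₁ (even-suc m)
parity-flip-or-loop {n = n} down = inj₁ (even-pred n)
parity-flip-or-loop (loop l) = inj₂ l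

-- A closed walk of odd length must use a loop, since every other step flips parity.
pentagon-NearLoop : ∀ {t n₀ n₁ n₂ n₃ n₄} →
  LevelStep t n₀ n₁ → LevelStep t n₁ n₂ → LevelStep t n₂ n₃ → LevelStep t n₃ n₄ → LevelStep t n₄ n₀ →
  NearLoop t n₀
pentagon-NearLoop r₀ r₁ r₂ r₃ r₄
  with parity-flip-or-loop r₀ | parity-flip-or-loop r₁ | parity-flip-or-loop r₂
     | parity-flip-or-loop r₃ | parity-flip-or-loop r₄
... | inj₂ l | _ | _ | _ | _ = Near₂-LoopLevel (m≤n⇒m≤1+n (n≤1+n _) , m≤n⇒m≤1+n (n≤1+n _)) l
... | inj₁ _ | inj₂ l | _ | _ | _ = Near₂-LoopLevel (Near⇒Near₂ (LevelStep⇒Near r₀)) l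
... | inj₁ _ | inj₁ _ | inj₂ l | _ | _ = Near₂-LoopLevel (Near∘Near⇒Near₂ (LevelStep⇒Near r₀) (LevelStep⇒Near r₁)) l
... | inj₁ _ | inj₁ _ | inj₁ _ | inj₂ l | _ =
  Near₂-LoopLevel (Near∘Near⇒Near₂ (Near-sym (LevelStep⇒Near r₄)) (Near-sym (LevelStep⇒Near r₃))) l
... | inj₁ _ | inj₁ _ | inj₁ _ | inj₁ _ | inj₂ l = Near₂-LoopLevel (Near⇒Near₂ (Near-sym (LevelStep⇒Near r₄))) l
... | inj₁ e₀ | inj₁ e₁ | inj₁ e₂ | inj₁ e₃ | inj₁ e₄ = ⊥-elim (odd-flips _ e₀ e₁ e₂ e₃ e₄)
  where
  odd-flips : ∀ {b₁ b₂ b₃ b₄} b₀ → b₁ ≡ not b₀ → b₂ ≡ not b₁ → b₃ ≡ not b₂ → b₄ ≡ not b₃ → b₀ ≡ not b₄ → ⊥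
  odd-flips true refl refl refl refl ()
  odd-flips false refl refl refl refl ()

LevelStep⇒≢ : ∀ {t m n} → LevelStep t m n → ¬ LoopLevel t m → m ≢ n
LevelStep⇒≢ up _ = 1+n≢n ∘ sym
LevelStep⇒≢ down _ = 1+n≢n
LevelStep⇒≢ (loop l) ¬l = contradiction l ¬l

¬LoopLevel-7 : ∀ {t} → ¬ LoopLevel t 7
¬LoopLevel-7 (inj₁ ())
¬LoopLevel-7 {t} (inj₂ 7≡) = not-¬ (even-double (suc t)) (cong even (sym 7≡))

¬LoopLevel-double : ∀ {t j} → j < t → ¬ LoopLevel t (j + j)
¬LoopLevel-double {j = j} _ (inj₁ j+j≡3) = not-¬ (even-double j) (cong even j+j≡3)
¬LoopLevel-double j<t (inj₂ j+j≡) = <⇒≢ (≤-trans (+-mono-< j<t j<t) (+-mono-≤ (n≤1+n _) (n≤1+n _))) j+j≡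

module _ {t : ℕ} (3<t : 3 < t) where

  private
    6<t+t : 6 < t + t
    6<t+t = ≤-trans (s≤s (s≤s (s≤s (s≤s (s≤s (s≤s (s≤s z≤n))))))) (+-mono-≤ 3<t 3<t)

  NearLoop-low : ∀ {m n} → NearLoop t n → Near m n → m ≤ 5 → n ≤ 5
  NearLoop-low (inj₁ n≤5) _ _ = n≤5
  NearLoop-low (inj₂ t+t≤n) (_ , n≤1+m) m≤5 = contradiction (≤-trans t+t≤n (≤-trans n≤1+m (s≤s m≤5))) (<⇒≱ 6<t+t)

  NearLoop-high : ∀ {m n} → NearLoop t n → Near m n → t + t ≤ m → t + t ≤ n
  NearLoop-high (inj₂ t+t≤n) _ _ = t+t≤n
  NearLoop-high (inj₁ n≤5) (m≤1+n , _) t+t≤m = contradiction (≤-trans t+t≤m (≤-trans m≤1+n (s≤s n≤5))) (<⇒≱ 6<t+t)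

-- Two rows o (at odd positions) and i (at all positions 1, …, 2n+1) forming a chain of
-- pentagons o b, o (b+2), i (b+2), i (b+1), i b.
module Ladder {t : ℕ} (3<t : 3 < t) (n : ℕ) (1≤n : 1 ≤ n) (o i : ℕ → ℕ)
  (o-step : ∀ q → even q ≡ false → suc (suc q) ≤ suc (n + n) → LevelStep t (o q) (o (suc (suc q))))
  (o-i : ∀ q → even q ≡ false → q ≤ suc (n + n) → LevelStep t (o q) (i q))
  (i-step : ∀ q → 1 ≤ q → suc q ≤ suc (n + n) → LevelStep t (i q) (i (suc q)))
  where

  private
    Q : ℕ
    Q = suc (n + n)

    Q-odd : even Q ≡ false
    Q-odd = trans (even-suc (n + n)) (cong not (even-double n))

    3≤Q : 3 ≤ Q
    3≤Q = s≤s (+-mono-≤ 1≤n 1≤n)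

  OnLadder : (ℕ → Set) → Set
  OnLadder P = (∀ q → even q ≡ false → q ≤ Q → P (o q)) × (∀ q → 1 ≤ q → q ≤ Q → P (i q))

  module Pentagon (b : ℕ) (b-odd : even b ≡ false) (b+2≤Q : suc (suc b) ≤ Q) where

    private
      b+1≤Q : suc b ≤ Q
      b+1≤Q = ≤-trans (n≤1+n _) b+2≤Q

      b≤Q : b ≤ Q
      b≤Q = ≤-trans (n≤1+n b) b+1≤Q

      r₀ : LevelStep t (o b) (o (suc (suc b)))
      r₀ = o-step b b-odd b+2≤Q
      r₁ : LevelStep t (o (suc (suc b))) (i (suc (suc b)))
      r₁ = o-i (suc (suc b)) b-odd b+2≤Q
      r₂ : LevelStep t (i (suc (suc b))) (i (suc b))
      r₂ = LevelStep-sym (i-step (suc b) (s≤s z≤n) b+2≤Q)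
      r₃ : LevelStep t (i (suc b)) (i b)
      r₃ = LevelStep-sym (i-step b (odd⇒1≤n b-odd) b+1≤Q)
      r₄ : LevelStep t (i b) (o b)
      r₄ = LevelStep-sym (o-i b b-odd b≤Q)

    o₀ : NearLoop t (o b)
    o₀ = pentagon-NearLoop r₀ r₁ r₂ r₃ r₄
    o₂ : NearLoop t (o (suc (suc b)))
    o₂ = pentagon-NearLoop r₁ r₂ r₃ r₄ r₀
    i₂ : NearLoop t (i (suc (suc b)))
    i₂ = pentagon-NearLoop r₂ r₃ r₄ r₀ r₁
    i₁ : NearLoop t (i (suc b))
    i₁ = pentagon-NearLoop r₃ r₄ r₀ r₁ r₂
    i₀ : NearLoop t (i b)
    i₀ = pentagon-NearLoop r₄ r₀ r₁ r₂ r₃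

  NearLoop-o : ∀ q → even q ≡ false → q ≤ Q → NearLoop t (o q)
  NearLoop-o q e q≤Q with suc (suc q) ≤? Q
  ... | yes q+2≤Q = Pentagon.o₀ q e q+2≤Q
  NearLoop-o (suc (suc q)) e q≤Q | no _ = Pentagon.o₂ q e q≤Q
  NearLoop-o (suc zero) e q≤Q | no q+2≰Q = contradiction 3≤Q q+2≰Q

  NearLoop-i : ∀ q → 1 ≤ q → q ≤ Q → NearLoop t (i q)
  NearLoop-i q 1≤q q≤Q with even q in e
  NearLoop-i (suc q) _ q≤Q | true =
    Pentagon.i₁ q (trans (even-pred q) (cong not e)) (≤∧≢⇒< q≤Q (λ { refl → not-¬ e Q-odd }))
  ... | false with suc (suc q) ≤? Q
  ...   | yes q+2≤Q = Pentagon.i₀ q e q+2≤Q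
  NearLoop-i (suc (suc q)) _ q≤Q | false | no _ = Pentagon.i₂ q e q≤Q
  NearLoop-i (suc zero) _ q≤Q | false | no q+2≰Q = contradiction 3≤Q q+2≰Q

  module _ (P : ℕ → Set) (P-near : ∀ {m n} → NearLoop t n → Near m n → P m → P n) (P-i₁ : P (i 1)) where

    propagate-i : ∀ q → 1 ≤ q → q ≤ Q → P (i q)
    propagate-i (suc zero) _ _ = P-i₁
    propagate-i (suc (suc q)) _ q+2≤Q =
      P-near (NearLoop-i (suc (suc q)) (s≤s z≤n) q+2≤Q)
             (LevelStep⇒Near (i-step (suc q) (s≤s z≤n) q+2≤Q))
             (propagate-i (suc q) (s≤s z≤n) (≤-trans (n≤1+n _) q+2≤Q))

    propagate : OnLadder P
    propagate = (λ q e q≤Q → P-near (NearLoop-o q e q≤Q) (Near-sym (LevelStep⇒Near (o-i q e q≤Q)))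
                                    (propagate-i q (odd⇒1≤n e) q≤Q))
              , propagate-i

  ladder-low-or-high : OnLadder (_≤ 5) ⊎ OnLadder (t + t ≤_)
  ladder-low-or-high with NearLoop-i 1 (s≤s z≤n) (s≤s z≤n)
  ... | inj₁ low = inj₁ (propagate (_≤ 5) (NearLoop-low 3<t) low)
  ... | inj₂ high = inj₂ (propagate (t + t ≤_) (NearLoop-high 3<t) high)

Between : ℕ → ℕ → ℕ → Set
Between x y q = (x ≤ q × q ≤ y) ⊎ (y ≤ q × q ≤ x)

private
  Between-refl : ∀ {x q} → Between x x q → x ≡ q
  Between-refl (inj₁ (x≤q , q≤x)) = ≤-antisym x≤q q≤x
  Between-refl (inj₂ (x≤q , q≤x)) = ≤-antisym x≤q q≤x

  Between-step : ∀ {x y y′ q} → Near y y′ → Between x y′ q → Between x y q ⊎ y′ ≡ q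
  Between-step {y = y} {q = q} (y≤ , y′≤) (inj₁ (x≤q , q≤y′)) with q ≤? y
  ... | yes q≤y = inj₁ (inj₁ (x≤q , q≤y))
  ... | no q≰y = inj₂ (≤-antisym (≤-trans y′≤ (≰⇒> q≰y)) q≤y′)
  Between-step {y = y} {q = q} (y≤ , y′≤) (inj₂ (y′≤q , q≤x)) with y ≤? q
  ... | yes y≤q = inj₁ (inj₂ (y≤q , q≤x))
  ... | no y≰q = inj₂ (≤-antisym y′≤q (≤-pred (≤-trans (≰⇒> y≰q) y≤)))

intermediate-value : ∀ (g : ℕ → ℕ) {a b q} → a ≤ b → (∀ k → a ≤ k → k < b → Near (g k) (g (suc k))) →
                     Between (g a) (g b) q → ∃ λ k → a ≤ k × k ≤ b × g k ≡ q
intermediate-value g {a} {b} a≤b steps btw with m≤n⇒m<n∨m≡n a≤b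
... | inj₂ refl = a , ≤-refl , ≤-refl , Between-refl btw
intermediate-value g {a} {suc b} a≤b steps btw | inj₁ (s≤s a≤b′) with Between-step (steps b a≤b′ ≤-refl) btw
... | inj₂ gb≡q = suc b , a≤b , ≤-refl , gb≡q
... | inj₁ btw′ with intermediate-value g a≤b′ (λ k a≤k k<b → steps k a≤k (≤-trans k<b (n≤1+n b))) btw′
...   | k , a≤k , k≤b , gk≡q = k , a≤k , m≤n⇒m≤1+n k≤b , gk≡q

-- Row j of the wall read from left to right: v_{1,j}, u_{1,j}, v_{2,j}, u_{2,j}, …
cell : ℕ → ℕ → Raw
cell j p = if even p then u ⌊ p /2⌋ j else v (suc ⌊ p /2⌋) j

row : Raw → ℕ
row (v _ j) = j
row (u _ j) = j

column : Raw → ℕ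
column (v i _) = pred (i + i)
column (u i _) = i + i

-- Levels 2j and 2j+1 in row j, chosen so that every edge of W_{s,t} moves the
-- level by one, except the edges of rows 1 and t+1, which stay at levels 3 and 2t+2.
level : Raw → ℕ
level (v _ j) = if even j then j + j else suc (j + j)
level (u _ j) = if even j then suc (j + j) else j + j

cell-even : ∀ {j p} → even p ≡ true → cell j p ≡ u ⌊ p /2⌋ j
cell-even e rewrite e = refl

cell-odd : ∀ {j p} → even p ≡ false → cell j p ≡ v (suc ⌊ p /2⌋) j
cell-odd e rewrite e = refl

row-cell : ∀ j p → row (cell j p) ≡ j
row-cell j p with even p
... | true = refl
... | false = refl

cell-row-column : ∀ {s t} (x : Vertex s t) → proj₁ x ≡ cell (row (proj₁ x)) (column (proj₁ x))
cell-row-column (v (suc i) j , _) rewrite +-suc i i | even-suc (i + i) | even-double i =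
  cong (λ k → v (suc k) j) (sym (⌊1+n+n/2⌋≡n i))
cell-row-column (u i j , _) rewrite even-double i = cong (λ k → u k j) (n≡⌊n+n/2⌋ i)

level-same-parity : ∀ j p → even p ≡ even j → level (cell j p) ≡ suc (j + j)
level-same-parity j p e with even p | even j in ej
... | true | true rewrite ej = refl
... | false | false rewrite ej = refl

level-opposite-parity : ∀ j p → even p ≡ not (even j) → level (cell j p) ≡ j + j
level-opposite-parity j p e with even p | even j in ej
... | true | false rewrite ej = refl
... | false | true rewrite ej = refl

level-bounds : ∀ r → row r + row r ≤ level r × level r ≤ suc (row r + row r)
level-bounds (v _ j) with even j
... | true = ≤-refl , n≤1+n _
... | false = n≤1+n _ , ≤-refl
level-bounds (u _ j) with even j
... | true = n≤1+n _ , ≤-refl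
... | false = ≤-refl , n≤1+n _

⌊level/2⌋≡row : ∀ r → ⌊ level r /2⌋ ≡ row r
⌊level/2⌋≡row (v _ j) with even j
... | true = sym (n≡⌊n+n/2⌋ j)
... | false = ⌊1+n+n/2⌋≡n j
⌊level/2⌋≡row (u _ j) with even j
... | true = ⌊1+n+n/2⌋≡n j
... | false = sym (n≡⌊n+n/2⌋ j)

private
  up′ : ∀ {t m n} → n ≡ suc m → LevelStep t m n
  up′ refl = up

level-edge : ∀ {s t a b} → Edge s t a b → LevelStep t (level a) (level b)
level-edge (bottom _) = loop (inj₁ refl)
level-edge {t = t} (topV o _) rewrite even-suc t | Odd⇒odd t o = loop (inj₂ refl)
level-edge {t = t} (topU e _) rewrite even-suc t | Even⇒even t e = loop (inj₂ refl)
level-edge (vu {j = j} _ _ _) with even j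
... | true = up
... | false = down
level-edge (uv {j = j} _ _ _) with even j
... | true = down
... | false = up
level-edge (vv {j = j} _ o _) rewrite even-suc j | Odd⇒odd j o = up′ (cong suc (+-suc j j))
level-edge (uu {j = j} _ e _) rewrite even-suc j | Even⇒even j e = up′ (cong suc (+-suc j j))

level-Adj : ∀ {s t a b} → Adj s t a b → LevelStep t (level a) (level b)
level-Adj (inj₁ e) = level-edge e
level-Adj (inj₂ e) = LevelStep-sym (level-edge e)

level-vertical : ∀ j p → even p ≡ even j → level (cell (suc j) p) ≡ suc (level (cell j p))
level-vertical j p p≡j = begin
  level (cell (suc j) p) ≡⟨ level-opposite-parity (suc j) p p≢j+1 ⟩
  suc j + suc j          ≡⟨ cong suc (+-suc j j) ⟩
  suc (suc (j + j))      ≡⟨ cong suc (level-same-parity j p p≡j) ⟨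
  suc (level (cell j p)) ∎
  where
  open ≡-Reasoning
  p≢j+1 : even p ≡ not (even (suc j))
  p≢j+1 = trans p≡j (sym (trans (cong not (even-suc j)) (not-involutive (even j))))

level-horizontal : ∀ j p q → even q ≡ not (even p) → even p ≡ even j → level (cell j p) ≡ suc (level (cell j q))
level-horizontal j p q q≢p p≡j =
  trans (level-same-parity j p p≡j) (cong suc (sym (level-opposite-parity j q (trans q≢p (cong not p≡j)))))

level-cell-bounds : ∀ j p → j + j ≤ level (cell j p) × level (cell j p) ≤ suc (j + j)
level-cell-bounds j p =
  subst (λ k → k + k ≤ level (cell j p) × level (cell j p) ≤ suc (k + k)) (row-cell j p) (level-bounds (cell j p))

cell-suc-even : ∀ j p → even p ≡ true → cell j (suc p) ≡ v (suc ⌊ p /2⌋) j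
cell-suc-even j p e =
  trans (cell-odd (trans (even-suc p) (cong not e))) (cong (λ k → v (suc k) j) (⌊1+n/2⌋-even p e))

cell-suc-odd : ∀ j p → even p ≡ false → cell j (suc p) ≡ u (suc ⌊ p /2⌋) j
cell-suc-odd j p e =
  trans (cell-even (trans (even-suc p) (cong not e))) (cong (λ k → u k j) (⌊1+n/2⌋-odd p e))

Edge-row⇒Near-column : ∀ {s t a b} → Edge s t a b → row a ≡ row b → 2 ≤ row a → row a ≤ t → Near (column a) (column b)
Edge-row⇒Near-column (bottom _) _ (s≤s ()) _
Edge-row⇒Near-column (topV _ _) _ _ t+1≤t = contradiction t+1≤t 1+n≰n
Edge-row⇒Near-column (topU _ _) _ _ t+1≤t = contradiction t+1≤t 1+n≰n
Edge-row⇒Near-column (vu {suc i} _ _ _) _ _ _ = m≤n⇒m≤1+n (n≤1+n _) , ≤-refl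
Edge-row⇒Near-column (uv {i} _ _ _) _ _ _ =
  m≤n⇒m≤1+n (≤-trans (n≤1+n _) (≤-reflexive (sym (+-suc i i)))) , ≤-reflexive (+-suc i i)
Edge-row⇒Near-column (vv _ _ _) j≡j+1 _ _ = contradiction j≡j+1 (1+n≢n ∘ sym)
Edge-row⇒Near-column (uu _ _ _) j≡j+1 _ _ = contradiction j≡j+1 (1+n≢n ∘ sym)

Adj-row⇒Near-column : ∀ {s t a b} → Adj s t a b → row a ≡ row b → 2 ≤ row a → row a ≤ t → Near (column a) (column b)
Adj-row⇒Near-column (inj₁ e) a≡b 2≤ ≤t = Edge-row⇒Near-column e a≡b 2≤ ≤t
Adj-row⇒Near-column (inj₂ e) a≡b 2≤ ≤t =
  Near-sym (Edge-row⇒Near-column e (sym a≡b) (subst (2 ≤_) a≡b 2≤) (subst (_≤ _) a≡b ≤t))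

-- Reflects the levels 3, …, 2t+2, exchanging 3 and 2t+2.
flipLevel : ℕ → ℕ → ℕ
flipLevel t n = (t + t + 5) ∸ n

private
  ∸-suc : ∀ {k m} → suc m ≤ k → k ∸ m ≡ suc (k ∸ suc m)
  ∸-suc {suc k} {m} (s≤s m≤k) = +-∸-assoc 1 m≤k

  flip-top : ∀ t → t + t + 5 ≡ (suc t + suc t) + 3
  flip-top = solve-∀

  flip-even : ∀ j d → (j + d) + (j + d) + 5 ≡ (j + j) + suc ((d + 2) + (d + 2))
  flip-even = solve-∀

  flip-odd : ∀ j d → (j + d) + (j + d) + 5 ≡ suc (j + j) + ((d + 2) + (d + 2))
  flip-odd = solve-∀

  ≤flipBound : ∀ {t n} → n ≤ suc t + suc t → n ≤ t + t + 5
  ≤flipBound {t} n≤ = ≤-trans n≤ (≤-trans (m≤m+n _ 3) (≤-reflexive (sym (flip-top t))))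

flipLevel-3 : ∀ t → flipLevel t 3 ≡ suc t + suc t
flipLevel-3 t = trans (cong (_∸ 3) (flip-top t)) (m+n∸n≡m (suc t + suc t) 3)

flipLevel-top : ∀ t → flipLevel t (suc t + suc t) ≡ 3
flipLevel-top t = trans (cong (_∸ (suc t + suc t)) (flip-top t)) (m+n∸m≡n (suc t + suc t) 3)

flipLevel-LevelStep : ∀ {t m n} → m ≤ suc t + suc t → n ≤ suc t + suc t → LevelStep t m n →
                      LevelStep t (flipLevel t m) (flipLevel t n)
flipLevel-LevelStep {t} {m} _ n≤ up =
  subst (λ k → LevelStep t k (flipLevel t (suc m))) (sym (∸-suc (≤flipBound n≤))) down
flipLevel-LevelStep {t} {n = n} m≤ _ down =
  subst (LevelStep t (flipLevel t (suc n))) (sym (∸-suc (≤flipBound m≤))) up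
flipLevel-LevelStep {t} _ _ (loop (inj₁ refl)) = loop (inj₂ (flipLevel-3 t))
flipLevel-LevelStep {t} _ _ (loop (inj₂ refl)) = loop (inj₁ (flipLevel-top t))

flipLevel-involutive : ∀ {t n} → n ≤ suc t + suc t → flipLevel t (flipLevel t n) ≡ n
flipLevel-involutive n≤ = m∸[m∸n]≡n (≤flipBound n≤)

flipLevel-≤5 : ∀ {t n} → t + t ≤ n → flipLevel t n ≤ 5
flipLevel-≤5 {t} t+t≤n = ≤-trans (∸-monoʳ-≤ (t + t + 5) t+t≤n) (≤-reflexive (m+n∸m≡n (t + t) 5))

5≤flipLevel : ∀ {t n} → n ≤ t + t → 5 ≤ flipLevel t n
5≤flipLevel {t} n≤t+t = ≤-trans (≤-reflexive (sym (m+n∸m≡n (t + t) 5))) (∸-monoʳ-≤ (t + t + 5) n≤t+t)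

t+t≤flipLevel : ∀ {t n} → n ≤ 5 → t + t ≤ flipLevel t n
t+t≤flipLevel {t} n≤5 = ≤-trans (≤-reflexive (sym (m+n∸n≡m (t + t) 5))) (∸-monoʳ-≤ (t + t + 5) n≤5)

⌊flipLevel/2⌋ : ∀ {t} j p → j ≤ t → ⌊ flipLevel t (level (cell j p)) /2⌋ ≡ (t ∸ j) + 2
⌊flipLevel/2⌋ {t} j p j≤t with same-or-opposite (even p) (even j)
... | inj₁ p≡j = begin
  ⌊ (t + t + 5) ∸ level (cell j p) /2⌋
    ≡⟨ cong (λ n → ⌊ (t + t + 5) ∸ n /2⌋) (level-same-parity j p p≡j) ⟩
  ⌊ (t + t + 5) ∸ suc (j + j) /2⌋
    ≡⟨ cong (λ k → ⌊ (k + k + 5) ∸ suc (j + j) /2⌋) t≡ ⟨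
  ⌊ (j + d) + (j + d) + 5 ∸ suc (j + j) /2⌋
    ≡⟨ cong (λ n → ⌊ n ∸ suc (j + j) /2⌋) (flip-odd j d) ⟩
  ⌊ suc (j + j) + ((d + 2) + (d + 2)) ∸ suc (j + j) /2⌋
    ≡⟨ cong ⌊_/2⌋ (m+n∸m≡n (suc (j + j)) _) ⟩
  ⌊ (d + 2) + (d + 2) /2⌋
    ≡⟨ n≡⌊n+n/2⌋ (d + 2) ⟨
  d + 2 ∎
  where
  open ≡-Reasoning
  d = t ∸ j
  t≡ : j + d ≡ t
  t≡ = m+[n∸m]≡n j≤t
... | inj₂ p≢j = begin
  ⌊ (t + t + 5) ∸ level (cell j p) /2⌋
    ≡⟨ cong (λ n → ⌊ (t + t + 5) ∸ n /2⌋) (level-opposite-parity j p p≢j) ⟩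
  ⌊ (t + t + 5) ∸ (j + j) /2⌋
    ≡⟨ cong (λ k → ⌊ (k + k + 5) ∸ (j + j) /2⌋) t≡ ⟨
  ⌊ (j + d) + (j + d) + 5 ∸ (j + j) /2⌋
    ≡⟨ cong (λ n → ⌊ n ∸ (j + j) /2⌋) (flip-even j d) ⟩
  ⌊ (j + j) + suc ((d + 2) + (d + 2)) ∸ (j + j) /2⌋
    ≡⟨ cong ⌊_/2⌋ (m+n∸m≡n (j + j) _) ⟩
  ⌊ suc ((d + 2) + (d + 2)) /2⌋
    ≡⟨ ⌊1+n+n/2⌋≡n (d + 2) ⟩
  d + 2 ∎
  where
  open ≡-Reasoning
  d = t ∸ j
  t≡ : j + d ≡ t
  t≡ = m+[n∸m]≡n j≤t

LevelMap : ℕ → ℕ → (Raw → ℕ) → Set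
LevelMap s t N = ∀ {a b} → Adj s t a b → LevelStep t (N a) (N b)

Even⇒2≤ : ∀ {j} → Even j → 1 ≤ j → 2 ≤ j
Even⇒2≤ {suc (suc j)} _ _ = s≤s (s≤s z≤n)

module Geometry (s t : ℕ) where

  lastColumn : ℕ
  lastColumn = suc s + suc s

  IsVertex-irrelevant : ∀ r (a b : IsVertex s t r) → a ≡ b
  IsVertex-irrelevant (v i j) ((a₁ , a₂) , inj₁ (a₃ , a₄)) ((b₁ , b₂) , inj₁ (b₃ , b₄))
    rewrite ≤-irrelevant a₁ b₁ | ≤-irrelevant a₂ b₂ | ≤-irrelevant a₃ b₃ | ≤-irrelevant a₄ b₄ = refl
  IsVertex-irrelevant (v i j) ((a₁ , a₂) , inj₂ (a₃ , a₄)) ((b₁ , b₂) , inj₂ (b₃ , b₄))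
    rewrite ≤-irrelevant a₁ b₁ | ≤-irrelevant a₂ b₂ | ≡-irrelevant a₃ b₃ | ≡-irrelevant a₄ b₄ = refl
  IsVertex-irrelevant (v i j) (_ , inj₁ (_ , a₄)) (_ , inj₂ (_ , refl)) = contradiction a₄ 1+n≰n
  IsVertex-irrelevant (v i j) (_ , inj₂ (_ , refl)) (_ , inj₁ (_ , b₄)) = contradiction b₄ 1+n≰n
  IsVertex-irrelevant (u i j) ((a₁ , a₂) , inj₁ (a₃ , a₄)) ((b₁ , b₂) , inj₁ (b₃ , b₄))
    rewrite ≤-irrelevant a₁ b₁ | ≤-irrelevant a₂ b₂ | ≤-irrelevant a₃ b₃ | ≤-irrelevant a₄ b₄ = refl
  IsVertex-irrelevant (u i j) ((a₁ , a₂) , inj₂ (a₃ , a₄)) ((b₁ , b₂) , inj₂ (b₃ , b₄))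
    rewrite ≤-irrelevant a₁ b₁ | ≤-irrelevant a₂ b₂ | ≡-irrelevant a₃ b₃ | ≡-irrelevant a₄ b₄ = refl
  IsVertex-irrelevant (u i j) (_ , inj₁ (_ , a₄)) (_ , inj₂ (_ , refl)) = contradiction a₄ 1+n≰n
  IsVertex-irrelevant (u i j) (_ , inj₂ (_ , refl)) (_ , inj₁ (_ , b₄)) = contradiction b₄ 1+n≰n

  vertex-≡ : ∀ {r r′} {a : IsVertex s t r} {b : IsVertex s t r′} → r ≡ r′ → _≡_ {A = Vertex s t} (r , a) (r′ , b)
  vertex-≡ {r} {a = a} {b} refl = cong (r ,_) (IsVertex-irrelevant r a b)

  Adj-sym : ∀ {a b} → Adj s t a b → Adj s t b a
  Adj-sym (inj₁ e) = inj₂ e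
  Adj-sym (inj₂ e) = inj₁ e

  <lastColumn⇒⌊/2⌋≤s : ∀ {p} → p < lastColumn → ⌊ p /2⌋ ≤ s
  <lastColumn⇒⌊/2⌋≤s p< = ≤-pred (⌊n/2⌋<m p<)

  odd⇒<lastColumn : ∀ {p} → even p ≡ false → p ≤ lastColumn → p < lastColumn
  odd⇒<lastColumn e p≤ = ≤∧≢⇒< p≤ (odd⇒≢double (suc s) e)

  isVertex-cell : ∀ {j p} → 2 ≤ j → j ≤ t → 1 ≤ p → p ≤ lastColumn → IsVertex s t (cell j p)
  isVertex-cell {j} {p} 2≤j j≤t 1≤p p≤ with even p in e
  ... | true = (1≤⌊n/2⌋ e 1≤p , ⌊n/2⌋≤m p≤) , inj₁ (2≤j , j≤t)
  ... | false = (s≤s z≤n , s≤s (<lastColumn⇒⌊/2⌋≤s (odd⇒<lastColumn e p≤))) , inj₁ (≤-trans (s≤s z≤n) 2≤j , j≤t)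

  Adj-row : ∀ {j p} → 2 ≤ j → j ≤ t → 1 ≤ p → suc p ≤ lastColumn → Adj s t (cell j p) (cell j (suc p))
  Adj-row {j} {p} 2≤j j≤t 1≤p sp≤ with even p in e
  ... | true rewrite cell-suc-even j p e = inj₁ (uv (1≤⌊n/2⌋ e 1≤p , <lastColumn⇒⌊/2⌋≤s sp≤) 2≤j j≤t)
  ... | false rewrite cell-suc-odd j p e =
    inj₁ (vu (s≤s z≤n , s≤s (<lastColumn⇒⌊/2⌋≤s sp≤)) 2≤j j≤t)

  Adj-column : ∀ {j p} → even p ≡ even j → 1 ≤ j → j ≤ t → 1 ≤ p → p ≤ lastColumn →
               Adj s t (cell j p) (cell (suc j) p)
  Adj-column {j} {p} ep≡ej 1≤j j≤t 1≤p p≤ with even p in e | even j in ej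
  ... | true | true = inj₁ (uu (1≤⌊n/2⌋ e 1≤p , ⌊n/2⌋≤m p≤) (even⇒Even j ej) (1≤j , j≤t))
  ... | false | false =
    inj₁ (vv (s≤s z≤n , s≤s (<lastColumn⇒⌊/2⌋≤s (odd⇒<lastColumn e p≤))) (odd⇒Odd j ej) (1≤j , j≤t))

  Adj-bottom : ∀ {p} → even p ≡ false → suc (suc p) ≤ lastColumn → Adj s t (cell 1 p) (cell 1 (suc (suc p)))
  Adj-bottom {p} e ssp≤ rewrite e = inj₁ (bottom (s≤s z≤n , <lastColumn⇒⌊/2⌋≤s (odd⇒<lastColumn e ssp≤)))

  Adj-top : ∀ {p} → even p ≡ even t → 1 ≤ p → suc (suc p) ≤ lastColumn →
            Adj s t (cell (suc t) p) (cell (suc t) (suc (suc p)))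
  Adj-top {p} ep≡et 1≤p ssp≤ with even p in e | even t in et
  ... | true | true = inj₁ (topU (even⇒Even t et) (1≤⌊n/2⌋ e 1≤p , <lastColumn⇒⌊/2⌋≤s (≤-trans (n≤1+n _) ssp≤)))
  ... | false | false = inj₁ (topV (odd⇒Odd t et) (s≤s z≤n , <lastColumn⇒⌊/2⌋≤s (odd⇒<lastColumn e ssp≤)))

  isVertex? : ∀ r → Dec (IsVertex s t r)
  isVertex? (v i j) =
    ((1 ≤? i) ×-dec (i ≤? suc s)) ×-dec (((1 ≤? j) ×-dec (j ≤? t)) ⊎-dec ((t % 2 ≟ 1) ×-dec (j ≟ suc t)))
  isVertex? (u i j) =
    ((1 ≤? i) ×-dec (i ≤? suc s)) ×-dec (((2 ≤? j) ×-dec (j ≤? t)) ⊎-dec ((t % 2 ≟ 0) ×-dec (j ≟ suc t)))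

  extend : {A : Set} → A → (Vertex s t → A) → Raw → A
  extend a f r with isVertex? r
  ... | yes r-vertex = f (r , r-vertex)
  ... | no _ = a

  extend-vertex : ∀ {A : Set} (a : A) (f : Vertex s t → A) (x : Vertex s t) → extend a f (proj₁ x) ≡ f x
  extend-vertex a f (r , r-vertex) with isVertex? r
  ... | yes _ = cong f (vertex-≡ refl)
  ... | no ¬r-vertex = contradiction r-vertex ¬r-vertex

  Edge⇒IsVertex : ∀ {a b} → 1 ≤ t → Edge s t a b → IsVertex s t a × IsVertex s t b
  Edge⇒IsVertex 1≤t (bottom (1≤i , i≤s)) =
    ((1≤i , m≤n⇒m≤1+n i≤s) , inj₁ (s≤s z≤n , 1≤t)) , ((s≤s z≤n , s≤s i≤s) , inj₁ (s≤s z≤n , 1≤t))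
  Edge⇒IsVertex _ (topV t-odd (1≤i , i≤s)) =
    ((1≤i , m≤n⇒m≤1+n i≤s) , inj₂ (t-odd , refl)) , ((s≤s z≤n , s≤s i≤s) , inj₂ (t-odd , refl))
  Edge⇒IsVertex _ (topU t-even (1≤i , i≤s)) =
    ((1≤i , m≤n⇒m≤1+n i≤s) , inj₂ (t-even , refl)) , ((s≤s z≤n , s≤s i≤s) , inj₂ (t-even , refl))
  Edge⇒IsVertex _ (vu i∈ 2≤j j≤t) = (i∈ , inj₁ (≤-trans (s≤s z≤n) 2≤j , j≤t)) , (i∈ , inj₁ (2≤j , j≤t))
  Edge⇒IsVertex _ (uv (1≤i , i≤s) 2≤j j≤t) =
    ((1≤i , m≤n⇒m≤1+n i≤s) , inj₁ (2≤j , j≤t)) , ((s≤s z≤n , s≤s i≤s) , inj₁ (≤-trans (s≤s z≤n) 2≤j , j≤t))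
  Edge⇒IsVertex _ (vv {j = j} i∈ j-odd (1≤j , j≤t)) with m≤n⇒m<n∨m≡n j≤t
  ... | inj₁ j<t = (i∈ , inj₁ (1≤j , j≤t)) , (i∈ , inj₁ (s≤s z≤n , j<t))
  ... | inj₂ refl = (i∈ , inj₁ (1≤j , j≤t)) , (i∈ , inj₂ (j-odd , refl))
  Edge⇒IsVertex _ (uu {j = j} i∈ j-even (1≤j , j≤t)) with m≤n⇒m<n∨m≡n j≤t
  ... | inj₁ j<t = (i∈ , inj₁ (Even⇒2≤ j-even 1≤j , j≤t)) , (i∈ , inj₁ (s≤s 1≤j , j<t))
  ... | inj₂ refl = (i∈ , inj₁ (Even⇒2≤ j-even 1≤j , j≤t)) , (i∈ , inj₂ (j-even , refl))

  Adj⇒IsVertex : ∀ {a b} → 1 ≤ t → Adj s t a b → IsVertex s t a × IsVertex s t b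
  Adj⇒IsVertex 1≤t (inj₁ e) = Edge⇒IsVertex 1≤t e
  Adj⇒IsVertex 1≤t (inj₂ e) = let (b-vertex , a-vertex) = Edge⇒IsVertex 1≤t e in a-vertex , b-vertex

  4≤lastColumn : 1 ≤ s → 4 ≤ lastColumn
  4≤lastColumn 1≤s = +-mono-≤ (s≤s 1≤s) (s≤s 1≤s)

  ladderLength : ℕ
  ladderLength = suc (s + s)

  -- The top ladder starts at column 2 when t is even, as row t+1 then consists of u's.
  topShift : ℕ
  topShift = if even t then 1 else 0

  -- The one column of row t outside the top ladder.
  topGap : ℕ
  topGap = if even t then 1 else lastColumn

  BottomSide : (Raw → ℕ) → (ℕ → Set) → Set
  BottomSide N P = (∀ q → even q ≡ false → q ≤ ladderLength → P (N (cell 1 q)))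
                 × (∀ q → 1 ≤ q → q ≤ ladderLength → P (N (cell 2 q)))

  TopSide : (Raw → ℕ) → (ℕ → Set) → Set
  TopSide N P = (∀ q → even q ≡ false → q ≤ ladderLength → P (N (cell (suc t) (q + topShift))))
              × (∀ q → 1 ≤ q → q ≤ ladderLength → P (N (cell t (q + topShift))))

  ≤ladderLength⇒≤lastColumn : ∀ {q} → q ≤ ladderLength → q ≤ lastColumn
  ≤ladderLength⇒≤lastColumn q≤ = ≤-trans q≤ (s≤s (+-monoʳ-≤ s (n≤1+n s)))

  <lastColumn⇒≤ladderLength : ∀ {q} → q < lastColumn → q ≤ ladderLength
  <lastColumn⇒≤ladderLength {q} q< = subst (q ≤_) (+-suc s s) (≤-pred q<)

  +topShift≤lastColumn : ∀ {q} → q ≤ ladderLength → q + topShift ≤ lastColumn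
  +topShift≤lastColumn {q} q≤ =
    ≤-trans (+-mono-≤ q≤ shift≤1) (≤-reflexive (trans (+-comm ladderLength 1) (cong suc (sym (+-suc s s)))))
    where
    shift≤1 : topShift ≤ 1
    shift≤1 with even t
    ... | true = ≤-refl
    ... | false = z≤n

  topShift-parity : ∀ {q} → even q ≡ false → even (q + topShift) ≡ even t
  topShift-parity {q} q-odd with even t
  ... | true = trans (cong even (+-comm q 1)) (trans (even-suc q) (cong not q-odd))
  ... | false = trans (cong even (+-identityʳ q)) q-odd

  row-t-column : ∀ {p} → 1 ≤ p → p ≤ lastColumn → p ≢ topGap → ∃ λ q → 1 ≤ q × q ≤ ladderLength × q + topShift ≡ p
  row-t-column {p} 1≤p p≤ p≢gap with even t
  row-t-column {suc zero} 1≤p p≤ p≢gap | true = contradiction refl p≢gap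
  row-t-column {suc (suc p)} 1≤p p≤ p≢gap | true = suc p , s≤s z≤n , <lastColumn⇒≤ladderLength p≤ , +-comm (suc p) 1
  ... | false = p , 1≤p , <lastColumn⇒≤ladderLength (≤∧≢⇒< p≤ p≢gap) , +-identityʳ p

  row-t+1-column : ∀ {p} → even p ≡ even t → 1 ≤ p → p ≤ lastColumn →
                   ∃ λ q → even q ≡ false × q ≤ ladderLength × q + topShift ≡ p
  row-t+1-column {p} p≡t 1≤p p≤ with even t
  row-t+1-column {suc p} p≡t 1≤p p≤ | true =
    p , trans (even-pred p) (cong not p≡t) , <lastColumn⇒≤ladderLength p≤ , +-comm p 1
  ... | false = p , p≡t , <lastColumn⇒≤ladderLength (odd⇒<lastColumn p≡t p≤) , +-identityʳ p

  TopSide-row-t : ∀ {N P p} → TopSide N P → 1 ≤ p → p ≤ lastColumn → p ≢ topGap → P (N (cell t p))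
  TopSide-row-t {N} {P} (_ , inner) 1≤p p≤ p≢gap with row-t-column 1≤p p≤ p≢gap
  ... | q , 1≤q , q≤ , refl = inner q 1≤q q≤

  topGap-cases : topGap ≡ 1 ⊎ topGap ≡ lastColumn
  topGap-cases with even t
  ... | true = inj₁ refl
  ... | false = inj₂ refl

  1≤topGap : 1 ≤ topGap
  1≤topGap with even t
  ... | true = s≤s z≤n
  ... | false = s≤s z≤n

  topGap≤lastColumn : topGap ≤ lastColumn
  topGap≤lastColumn with even t
  ... | true = s≤s z≤n
  ... | false = ≤-refl

  topGap-t-even : even t ≡ true → topGap ≡ 1
  topGap-t-even t-even rewrite t-even = refl

  topGap-parity : ∀ {j} → suc j ≡ t → even topGap ≡ even j
  topGap-parity {j} refl with even (suc j) in e
  ... | true = sym (trans (even-pred j) (cong not e))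
  ... | false = trans (even-double (suc s)) (sym (trans (even-pred j) (cong not e)))

  data Region (r : Raw) : Set where
    bottom-outer  : ∀ q → even q ≡ false → q ≤ ladderLength → r ≡ cell 1 q → Region r
    bottom-inner  : ∀ q → 1 ≤ q → q ≤ ladderLength → r ≡ cell 2 q → Region r
    bottom-corner : r ≡ cell 2 lastColumn → Region r
    middle        : ∀ j p → 3 ≤ j → suc j ≤ t → 1 ≤ p → p ≤ lastColumn → r ≡ cell j p → Region r
    top-corner    : r ≡ cell t topGap → Region r
    top-inner     : ∀ q → 1 ≤ q → q ≤ ladderLength → r ≡ cell t (q + topShift) → Region r
    top-outer     : ∀ q → even q ≡ false → q ≤ ladderLength → r ≡ cell (suc t) (q + topShift) → Region r

  private
    region-below-top : ∀ {r j p} → r ≡ cell j p → 1 ≤ j → j ≤ t → (j ≡ 1 → even p ≡ false) →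
                       1 ≤ p → p ≤ lastColumn → Region r
    region-below-top {j = j} {p} r≡ 1≤j j≤t row1-odd 1≤p p≤ with j ≟ 1 | j ≟ 2 | j ≟ t
    ... | yes refl | _ | _ =
      bottom-outer p (row1-odd refl) (<lastColumn⇒≤ladderLength (odd⇒<lastColumn (row1-odd refl) p≤)) r≡
    ... | no _ | yes refl | _ with p ≟ lastColumn
    ...   | yes refl = bottom-corner r≡
    ...   | no p≢ = bottom-inner p 1≤p (<lastColumn⇒≤ladderLength (≤∧≢⇒< p≤ p≢)) r≡
    region-below-top {p = p} r≡ 1≤j j≤t _ 1≤p p≤ | no _ | no _ | yes refl with p ≟ topGap
    ...   | yes refl = top-corner r≡
    ...   | no p≢ with row-t-column 1≤p p≤ p≢
    ...     | q , 1≤q , q≤ , refl = top-inner q 1≤q q≤ r≡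
    region-below-top r≡ 1≤j j≤t _ 1≤p p≤ | no j≢1 | no j≢2 | no j≢t =
      middle _ _ (≤∧≢⇒< (≤∧≢⇒< 1≤j (j≢1 ∘ sym)) (j≢2 ∘ sym)) (≤∧≢⇒< j≤t j≢t) 1≤p p≤ r≡

    v-column : ∀ {i} → 1 ≤ i → i ≤ suc s → even (pred (i + i)) ≡ false × 1 ≤ pred (i + i) × pred (i + i) ≤ lastColumn
    v-column {suc i} _ i≤ =
      trans (cong even (+-suc i i)) (trans (even-suc (i + i)) (cong not (even-double i))) ,
      ≤-trans (s≤s z≤n) (m≤n+m (suc i) i) , ≤-trans (n≤1+n _) (+-mono-≤ i≤ i≤)

    u-column : ∀ {i} → 1 ≤ i → i ≤ suc s → 1 ≤ i + i × i + i ≤ lastColumn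
    u-column 1≤i i≤ = ≤-trans 1≤i (m≤m+n _ _) , +-mono-≤ i≤ i≤

  region : (x : Vertex s t) → Region (proj₁ x)
  region x@(v i j , (1≤i , i≤) , inj₁ (1≤j , j≤t)) =
    let (odd , 1≤p , p≤) = v-column 1≤i i≤ in region-below-top (cell-row-column x) 1≤j j≤t (λ _ → odd) 1≤p p≤
  region x@(v i j , (1≤i , i≤) , inj₂ (t-odd , refl)) with v-column 1≤i i≤
  ... | odd , 1≤p , p≤ with row-t+1-column (trans odd (sym (Odd⇒odd t t-odd))) 1≤p p≤
  ...   | q , q-odd , q≤ , q≡ = top-outer q q-odd q≤ (trans (cell-row-column x) (cong (cell (suc t)) (sym q≡)))
  region x@(u i j , (1≤i , i≤) , inj₁ (2≤j , j≤t)) =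
    let (1≤p , p≤) = u-column 1≤i i≤ in
    region-below-top (cell-row-column x) (≤-trans (s≤s z≤n) 2≤j) j≤t
      (λ { refl → contradiction 2≤j λ { (s≤s ()) } }) 1≤p p≤
  region x@(u i j , (1≤i , i≤) , inj₂ (t-even , refl)) with u-column 1≤i i≤
  ... | 1≤p , p≤ with row-t+1-column (trans (even-double i) (sym (Even⇒even t t-even))) 1≤p p≤
  ...   | q , q-odd , q≤ , q≡ = top-outer q q-odd q≤ (trans (cell-row-column x) (cong (cell (suc t)) (sym q≡)))

  record RowNeighbour (p f : ℕ) : Set where
    field
      q      : ℕ
      1≤q    : 1 ≤ q
      q≤     : q ≤ lastColumn
      q≢f    : q ≢ f
      parity : even q ≡ not (even p)
      next   : q ≡ suc p ⊎ suc q ≡ p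

  private
    left-neighbour : ∀ {p f} → 3 ≤ p → p ≤ lastColumn → f ≡ 1 ⊎ f ≡ lastColumn → RowNeighbour p f
    left-neighbour {suc p} (s≤s 2≤p) p≤ f∈ =
      record { q = p ; 1≤q = ≤-trans (s≤s z≤n) 2≤p ; q≤ = ≤-trans (n≤1+n p) p≤ ; q≢f = p≢f f∈
             ; parity = even-pred p ; next = inj₂ refl }
      where
      p≢f : ∀ {f} → f ≡ 1 ⊎ f ≡ lastColumn → p ≢ f
      p≢f (inj₁ refl) refl = contradiction 2≤p λ { (s≤s ()) }
      p≢f (inj₂ refl) refl = contradiction p≤ 1+n≰n

  row-neighbour : 1 ≤ s → ∀ {p f} → 1 ≤ p → p ≤ lastColumn → f ≡ 1 ⊎ f ≡ lastColumn → RowNeighbour p f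
  row-neighbour 1≤s {p} {f} 1≤p p≤ f∈ with suc p ≤? lastColumn | suc p ≟ f
  ... | yes p+1≤ | no p+1≢f =
    record { q = suc p ; 1≤q = s≤s z≤n ; q≤ = p+1≤ ; q≢f = p+1≢f ; parity = even-suc p ; next = inj₁ refl }
  ... | yes _ | yes refl with f∈
  ...   | inj₁ p+1≡1 = contradiction (cong pred p+1≡1) (λ p≡0 → contradiction (subst (1 ≤_) p≡0 1≤p) λ ())
  ...   | inj₂ p+1≡last = left-neighbour (≤-pred (subst (4 ≤_) (sym p+1≡last) (4≤lastColumn 1≤s))) p≤ f∈
  row-neighbour 1≤s {p} 1≤p p≤ f∈ | no p+1≰ | _ =
    left-neighbour (subst (3 ≤_) (sym p≡last) (≤-trans (n≤1+n 3) (4≤lastColumn 1≤s))) p≤ f∈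
    where
    p≡last : p ≡ lastColumn
    p≡last = ≤-antisym p≤ (≤-pred (≰⇒> p+1≰))

  neighbour≤suc : ∀ {p f} (n : RowNeighbour p f) → RowNeighbour.q n ≤ suc p
  neighbour≤suc record { next = inj₁ refl } = ≤-refl
  neighbour≤suc record { next = inj₂ refl } = m≤n⇒m≤1+n (n≤1+n _)

  Adj-neighbour : ∀ {j p f} → 2 ≤ j → j ≤ t → 1 ≤ p → p ≤ lastColumn → (n : RowNeighbour p f) →
                  Adj s t (cell j p) (cell j (RowNeighbour.q n))
  Adj-neighbour 2≤j j≤t 1≤p p≤ record { q≤ = q≤ ; next = inj₁ refl } = Adj-row 2≤j j≤t 1≤p q≤
  Adj-neighbour 2≤j j≤t 1≤p p≤ record { 1≤q = 1≤q ; next = inj₂ refl } = Adj-sym (Adj-row 2≤j j≤t 1≤q p≤)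

  InMiddleRows : Raw → Set
  InMiddleRows r = ∃₂ λ j p → 3 ≤ j × suc j ≤ t × 1 ≤ p × p ≤ lastColumn × r ≡ cell j p

  Corner : Raw → Set
  Corner r = r ≡ cell 2 lastColumn ⊎ r ≡ cell t topGap

  corners-collide : ∀ {a b c} → Corner a → Corner b → Corner c → a ≡ b ⊎ a ≡ c ⊎ b ≡ c
  corners-collide (inj₁ a≡) (inj₁ b≡) _ = inj₁ (trans a≡ (sym b≡))
  corners-collide (inj₂ a≡) (inj₂ b≡) _ = inj₁ (trans a≡ (sym b≡))
  corners-collide (inj₁ a≡) (inj₂ _) (inj₁ c≡) = inj₂ (inj₁ (trans a≡ (sym c≡)))
  corners-collide (inj₂ a≡) (inj₁ _) (inj₂ c≡) = inj₂ (inj₁ (trans a≡ (sym c≡)))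
  corners-collide (inj₁ _) (inj₂ b≡) (inj₂ c≡) = inj₂ (inj₂ (trans b≡ (sym c≡)))
  corners-collide (inj₂ _) (inj₁ b≡) (inj₁ c≡) = inj₂ (inj₂ (trans b≡ (sym c≡)))

  level-range : ∀ (x : Vertex s t) → level (proj₁ x) ≤ suc t + suc t
  level-range (v i j , _ , inj₁ (_ , j≤t)) =
    ≤-trans (proj₂ (level-bounds (v i j))) (s≤s (≤-trans (+-mono-≤ j≤t j≤t) (+-monoʳ-≤ t (n≤1+n t))))
  level-range (v i _ , _ , inj₂ (t-odd , refl)) rewrite even-suc t | Odd⇒odd t t-odd = ≤-refl
  level-range (u i j , _ , inj₁ (_ , j≤t)) =
    ≤-trans (proj₂ (level-bounds (u i j))) (s≤s (≤-trans (+-mono-≤ j≤t j≤t) (+-monoʳ-≤ t (n≤1+n t))))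
  level-range (u i _ , _ , inj₂ (t-even , refl)) rewrite even-suc t | Even⇒even t t-even = ≤-refl

  extend-≤ : ∀ {a k} (f : Vertex s t → ℕ) → a ≤ k → (∀ x → f x ≤ k) → ∀ r → extend a f r ≤ k
  extend-≤ f a≤k f≤k r with isVertex? r
  ... | yes r-vertex = f≤k (r , r-vertex)
  ... | no _ = a≤k

  ≡-position : ∀ (x y : Vertex s t) → row (proj₁ x) ≡ row (proj₁ y) → column (proj₁ x) ≡ column (proj₁ y) → x ≡ y
  ≡-position x y row≡ column≡ =
    vertex-≡ (trans (cell-row-column x) (trans (cong₂ cell row≡ column≡) (sym (cell-row-column y))))

  Interior : Raw → Set
  Interior r = (3 ≤ row r × suc (row r) ≤ t) × (4 ≤ column r × suc (column r) ≤ s + s)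

  private
    3≤ : ∀ {j} → 1 ≤ j → j ≢ 1 → j ≢ 2 → 3 ≤ j
    3≤ 1≤j j≢1 j≢2 = ≤∧≢⇒< (≤∧≢⇒< 1≤j (j≢1 ∘ sym)) (j≢2 ∘ sym)

  F-or-interior : ∀ (z : Vertex s t) → F s t (proj₁ z) ⊎ Interior (proj₁ z)
  F-or-interior (v i _ , i∈ , inj₂ top) = inj₁ (inj₁ (i∈ , inj₂ (inj₂ top)))
  F-or-interior (u i _ , i∈ , inj₂ top) = inj₁ (inj₁ (i∈ , inj₂ (inj₂ top)))
  F-or-interior (v i j , i∈@(1≤i , i≤) , inj₁ (1≤j , j≤t)) with j ≤? 2 | j ≟ t
  ... | yes j≤2 | _ = inj₁ (inj₁ (i∈ , inj₁ (1≤j , j≤2)))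
  ... | no _ | yes j≡t = inj₁ (inj₁ (i∈ , inj₂ (inj₁ j≡t)))
  ... | no j≰2 | no j≢t with i ≟ 1 | i ≟ 2 | i ≟ suc s
  ...   | yes i≡1 | _ | _ = inj₁ (inj₂ ((≰⇒> j≰2 , ≤∧≢⇒< j≤t j≢t) , inj₁ i≡1))
  ...   | no _ | yes i≡2 | _ = inj₁ (inj₂ ((≰⇒> j≰2 , ≤∧≢⇒< j≤t j≢t) , inj₂ (inj₁ i≡2)))
  ...   | no _ | no _ | yes i≡s+1 = inj₁ (inj₂ ((≰⇒> j≰2 , ≤∧≢⇒< j≤t j≢t) , inj₂ (inj₂ i≡s+1)))
  ...   | no i≢1 | no i≢2 | no i≢s+1 =
    inj₂ ((≰⇒> j≰2 , ≤∧≢⇒< j≤t j≢t) , column-bounds i (3≤ 1≤i i≢1 i≢2) (≤-pred (≤∧≢⇒< i≤ i≢s+1)))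
    where
    column-bounds : ∀ i → 3 ≤ i → i ≤ s → 4 ≤ pred (i + i) × suc (pred (i + i)) ≤ s + s
    column-bounds (suc i) (s≤s 2≤i) i<s =
      ≤-trans (+-mono-≤ 2≤i 2≤i) (+-monoʳ-≤ i (n≤1+n i)) , +-mono-≤ i<s i<s
  F-or-interior (u i j , i∈@(1≤i , i≤) , inj₁ (2≤j , j≤t)) with j ≟ 2 | j ≟ t
  ... | yes j≡2 | _ = inj₁ (inj₁ (i∈ , inj₁ j≡2))
  ... | no _ | yes j≡t = inj₁ (inj₁ (i∈ , inj₂ (inj₁ j≡t)))
  ... | no j≢2 | no j≢t with i ≟ 1 | i ≟ s | i ≟ suc s
  ...   | yes i≡1 | _ | _ = inj₁ (inj₂ ((≤∧≢⇒< 2≤j (j≢2 ∘ sym) , ≤∧≢⇒< j≤t j≢t) , inj₁ i≡1))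
  ...   | no _ | yes i≡s | _ = inj₁ (inj₂ ((≤∧≢⇒< 2≤j (j≢2 ∘ sym) , ≤∧≢⇒< j≤t j≢t) , inj₂ (inj₁ i≡s)))
  ...   | no _ | no _ | yes i≡s+1 = inj₁ (inj₂ ((≤∧≢⇒< 2≤j (j≢2 ∘ sym) , ≤∧≢⇒< j≤t j≢t) , inj₂ (inj₂ i≡s+1)))
  ...   | no i≢1 | no i≢s | no i≢s+1 =
    inj₂ ((≤∧≢⇒< 2≤j (j≢2 ∘ sym) , ≤∧≢⇒< j≤t j≢t) , +-mono-≤ 2≤i 2≤i ,
          ≤-trans (s≤s (+-monoʳ-≤ i (n≤1+n i))) (+-mono-≤ i<s i<s))
    where
    2≤i : 2 ≤ i
    2≤i = ≤∧≢⇒< 1≤i (i≢1 ∘ sym)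
    i<s : suc i ≤ s
    i<s = ≤∧≢⇒< (≤-pred (≤∧≢⇒< i≤ i≢s+1)) i≢s

module Sides {s t : ℕ} (1≤s : 1 ≤ s) (3<t : 3 < t) {N : Raw → ℕ} (N-map : LevelMap s t N) where
  open Geometry s t

  private
    1≤t : 1 ≤ t
    1≤t = ≤-trans (s≤s z≤n) 3<t

    2≤t : 2 ≤ t
    2≤t = ≤-trans (s≤s (s≤s z≤n)) 3<t

  bottom-low-or-high : BottomSide N (_≤ 5) ⊎ BottomSide N (t + t ≤_)
  bottom-low-or-high = Ladder.ladder-low-or-high 3<t s 1≤s (λ q → N (cell 1 q)) (λ q → N (cell 2 q))
    (λ q q-odd q+2≤ → N-map (Adj-bottom q-odd (≤ladderLength⇒≤lastColumn q+2≤)))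
    (λ q q-odd q≤ → N-map (Adj-column q-odd ≤-refl 1≤t (odd⇒1≤n q-odd) (≤ladderLength⇒≤lastColumn q≤)))
    (λ q 1≤q q+1≤ → N-map (Adj-row ≤-refl 2≤t 1≤q (≤ladderLength⇒≤lastColumn q+1≤)))

  top-low-or-high : TopSide N (_≤ 5) ⊎ TopSide N (t + t ≤_)
  top-low-or-high = Ladder.ladder-low-or-high 3<t s 1≤s
    (λ q → N (cell (suc t) (q + topShift))) (λ q → N (cell t (q + topShift)))
    (λ q q-odd q+2≤ → N-map (Adj-top {q + topShift} (topShift-parity {q} q-odd)
                                     (≤-trans (odd⇒1≤n {q} q-odd) (m≤m+n q _)) (+topShift≤lastColumn q+2≤)))
    (λ q q-odd q≤ → N-map (Adj-sym (Adj-column {t} {q + topShift} (topShift-parity {q} q-odd) 1≤t ≤-refl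
                                  (≤-trans (odd⇒1≤n {q} q-odd) (m≤m+n q _)) (+topShift≤lastColumn q≤))))
    (λ q 1≤q q+1≤ → N-map (Adj-row {t} {q + topShift} 2≤t ≤-refl (≤-trans 1≤q (m≤m+n q _))
                                   (+topShift≤lastColumn q+1≤)))

-- Every cell of a middle row has a neighbour one level lower and one level higher. Hence with
-- the bottom ladder at levels ≤ 5, N ≤ level spreads upwards from row 2, and with the top
-- ladder at levels ≥ 2t, N ≥ level spreads downwards from row t; each misses the corner
-- next to the gap of its ladder, where the level is then pinned by a neighbour.
module Bounds {s t : ℕ} (1≤s : 1 ≤ s) (3<t : 3 < t) {N : Raw → ℕ} (N-map : LevelMap s t N)
  (bottom-low : Geometry.BottomSide s t N (_≤ 5)) where
  open Geometry s t

  private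
    2≤t : 2 ≤ t
    2≤t = ≤-trans (s≤s (s≤s z≤n)) 3<t

    3≤t : 3 ≤ t
    3≤t = ≤-trans (n≤1+n 3) 3<t

    ≤-across : ∀ {a b k} → Adj s t a b → N b ≤ k → N a ≤ suc k
    ≤-across adj Nb≤k = ≤-trans (proj₁ (LevelStep⇒Near (N-map adj))) (s≤s Nb≤k)

    ≥-across : ∀ {a b k} → Adj s t a b → k ≤ N b → k ≤ suc (N a)
    ≥-across adj k≤Nb = ≤-trans k≤Nb (proj₂ (LevelStep⇒Near (N-map adj)))

    ≤level-across : ∀ {a b} → Adj s t a b → level a ≡ suc (level b) → N b ≤ level b → N a ≤ level a
    ≤level-across {a} adj eq Nb≤ = subst (N a ≤_) (sym eq) (≤-across adj Nb≤)

    level≤-across : ∀ {a b} → Adj s t a b → level b ≡ suc (level a) → level b ≤ N b → level a ≤ N a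
    level≤-across {a} adj eq ≤Nb = ≤-pred (subst (_≤ suc (N a)) eq (≥-across adj ≤Nb))

    lastColumn-even : even lastColumn ≡ true
    lastColumn-even = even-double (suc s)

    1≤beforeLast : 1 ≤ s + suc s
    1≤beforeLast = ≤-trans (s≤s z≤n) (m≤n+m (suc s) s)

  ≤level-down : ∀ {j p} → 3 ≤ j → suc j ≤ t → even p ≡ not (even j) → 1 ≤ p → p ≤ lastColumn →
                (j ≡ 3 → p ≢ lastColumn) → N (cell j p) ≤ level (cell j p)
  ≤level-up : ∀ {j p} → 3 ≤ j → suc j ≤ t → even p ≡ even j → 1 ≤ p → p ≤ lastColumn →
              N (cell j p) ≤ level (cell j p)

  ≤level-down {3} {p} _ _ p-even 1≤p p≤ p≢last =
    ≤level-across (Adj-sym (Adj-column {2} {p} p-even (s≤s z≤n) 2≤t 1≤p p≤)) (level-vertical 2 p p-even)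
      (subst (N (cell 2 p) ≤_) (sym (level-same-parity 2 p p-even))
        (proj₂ bottom-low p 1≤p (<lastColumn⇒≤ladderLength (≤∧≢⇒< p≤ (p≢last refl)))))
  ≤level-down {suc (suc (suc (suc j)))} {p} _ j+1<t p-parity 1≤p p≤ _ =
    ≤level-across (Adj-sym (Adj-column {suc (suc (suc j))} {p} p≡j (s≤s z≤n) (≤-trans (n≤1+n _) j<t) 1≤p p≤))
      (level-vertical _ p p≡j) (≤level-up (s≤s (s≤s (s≤s z≤n))) j<t p≡j 1≤p p≤)
    where
    j<t : suc (suc (suc (suc j))) ≤ t
    j<t = ≤-trans (n≤1+n _) j+1<t

    p≡j : even p ≡ even (suc (suc (suc j)))
    p≡j = trans p-parity (sym (even-pred (suc (suc (suc j)))))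

  ≤level-down {suc zero} (s≤s ())
  ≤level-down {suc (suc zero)} (s≤s (s≤s ()))

  ≤level-up {j} {p} 3≤j j<t p≡j 1≤p p≤ =
    ≤level-across (Adj-neighbour {j} {p} 2≤j (≤-trans (n≤1+n j) j<t) 1≤p p≤ n) (level-horizontal j p q parity p≡j)
      (≤level-down 3≤j j<t (trans parity (cong not p≡j)) 1≤q q≤ (λ _ → q≢f))
    where
    2≤j = ≤-trans (n≤1+n 2) 3≤j
    n = row-neighbour 1≤s 1≤p p≤ (inj₂ refl)
    open RowNeighbour n

  ≤level : ∀ {j p} → 3 ≤ j → suc j ≤ t → 1 ≤ p → p ≤ lastColumn → (j ≡ 3 → p ≢ lastColumn) →
           N (cell j p) ≤ level (cell j p)
  ≤level {j} {p} 3≤j j<t 1≤p p≤ exception with same-or-opposite (even p) (even j)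
  ... | inj₁ p≡j = ≤level-up 3≤j j<t p≡j 1≤p p≤
  ... | inj₂ p≢j = ≤level-down 3≤j j<t p≢j 1≤p p≤ exception

  ≤6-bottom-corner : N (cell 2 lastColumn) ≤ 6
  ≤6-bottom-corner =
    ≤-across (Adj-sym (Adj-row ≤-refl 2≤t 1≤beforeLast ≤-refl))
             (proj₂ bottom-low (s + suc s) 1≤beforeLast (≤-reflexive (+-suc s s)))

  ≤7-above-bottom-corner : N (cell 3 lastColumn) ≤ 7
  ≤7-above-bottom-corner =
    ≤-across (Adj-sym (Adj-column lastColumn-even (s≤s z≤n) 2≤t (s≤s z≤n) ≤-refl)) ≤6-bottom-corner

  private
    ≤t+t : ∀ {n} → n ≤ 7 → n ≤ t + t
    ≤t+t n≤7 = ≤-trans n≤7 (≤-trans (n≤1+n 7) (+-mono-≤ 3<t 3<t))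

    1+double≤t+t : ∀ {j} → suc j ≤ t → suc (j + j) ≤ t + t
    1+double≤t+t {j} j<t = ≤-trans (n≤1+n _) (subst (_≤ t + t) (cong suc (+-suc j j)) (+-mono-≤ j<t j<t))

    topNeighbour : RowNeighbour topGap topGap
    topNeighbour = row-neighbour 1≤s 1≤topGap topGap≤lastColumn topGap-cases

    Adj-topNeighbour : Adj s t (cell t topGap) (cell t (RowNeighbour.q topNeighbour))
    Adj-topNeighbour = Adj-neighbour 2≤t ≤-refl 1≤topGap topGap≤lastColumn topNeighbour

    ≤t+t-middle : ∀ {j p} → 3 ≤ j → suc j ≤ t → 1 ≤ p → p ≤ lastColumn → (j ≡ 3 → p ≢ lastColumn) →
                  N (cell j p) ≤ t + t
    ≤t+t-middle {j} {p} 3≤j j<t 1≤p p≤ exception =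
      ≤-trans (≤level 3≤j j<t 1≤p p≤ exception) (≤-trans (proj₂ (level-cell-bounds j p)) (1+double≤t+t j<t))

  module _ (top-low : TopSide N (_≤ 5)) where

    ≤t+t-everywhere : ∀ (x : Vertex s t) → N (proj₁ x) ≤ t + t
    ≤t+t-everywhere x with region x
    ... | bottom-outer q q-odd q≤ refl = ≤t+t (m≤n⇒m≤1+n (m≤n⇒m≤1+n (proj₁ bottom-low q q-odd q≤)))
    ... | bottom-inner q 1≤q q≤ refl = ≤t+t (m≤n⇒m≤1+n (m≤n⇒m≤1+n (proj₂ bottom-low q 1≤q q≤)))
    ... | bottom-corner refl = ≤t+t (m≤n⇒m≤1+n ≤6-bottom-corner)
    ... | top-corner refl = ≤t+t (m≤n⇒m≤1+n (≤-across Adj-topNeighbour (TopSide-row-t {N} {_≤ 5} top-low 1≤q q≤ q≢f)))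
      where open RowNeighbour topNeighbour
    ... | top-inner q 1≤q q≤ refl = ≤t+t (m≤n⇒m≤1+n (m≤n⇒m≤1+n (proj₂ top-low q 1≤q q≤)))
    ... | top-outer q q-odd q≤ refl = ≤t+t (m≤n⇒m≤1+n (m≤n⇒m≤1+n (proj₁ top-low q q-odd q≤)))
    ... | middle j p 3≤j j<t 1≤p p≤ refl with j ≟ 3 | p ≟ lastColumn
    ...   | yes refl | yes refl = ≤t+t ≤7-above-bottom-corner
    ...   | yes refl | no p≢last = ≤t+t-middle 3≤j j<t 1≤p p≤ (λ _ → p≢last)
    ...   | no j≢3 | _ = ≤t+t-middle 3≤j j<t 1≤p p≤ (λ j≡3 → contradiction j≡3 j≢3)

  module _ (top-high : TopSide N (t + t ≤_)) where

    private
      row-t-high : ∀ {p} → 1 ≤ p → p ≤ lastColumn → p ≢ topGap → t + t ≤ N (cell t p)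
      row-t-high = TopSide-row-t {N} {t + t ≤_} top-high

      ≤t : ∀ {d j} → d + suc j ≡ t → j ≤ t
      ≤t {d} {j} eq = ≤-trans (n≤1+n j) (subst (suc j ≤_) eq (m≤n+m (suc j) d))

    level≤-up : ∀ d {j p} → d + suc j ≡ t → 2 ≤ j → even p ≡ even j → 1 ≤ p → p ≤ lastColumn →
                (suc j ≡ t → p ≢ topGap) → level (cell j p) ≤ N (cell j p)
    level≤-down : ∀ d {j p} → d + suc j ≡ t → 2 ≤ j → even p ≡ not (even j) → 1 ≤ p → p ≤ lastColumn →
                  level (cell j p) ≤ N (cell j p)

    level≤-up zero {j} {p} refl 2≤j p≡j 1≤p p≤ exception =
      level≤-across (Adj-column {j} {p} p≡j (≤-trans (s≤s z≤n) 2≤j) (n≤1+n j) 1≤p p≤) (level-vertical j p p≡j)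
        (subst (_≤ N (cell (suc j) p)) (sym (level-opposite-parity (suc j) p (trans p≡j (even-pred j))))
          (row-t-high 1≤p p≤ (exception refl)))
    level≤-up (suc d) {j} {p} eq 2≤j p≡j 1≤p p≤ _ =
      level≤-across (Adj-column {j} {p} p≡j (≤-trans (s≤s z≤n) 2≤j) (≤t {suc d} eq) 1≤p p≤) (level-vertical j p p≡j)
        (level≤-down d (trans (+-suc d (suc j)) eq) (≤-trans 2≤j (n≤1+n j)) (trans p≡j (even-pred j)) 1≤p p≤)

    level≤-down d {j} {p} eq 2≤j p≢j 1≤p p≤ =
      level≤-across (Adj-neighbour {j} {p} 2≤j (≤t {d} eq) 1≤p p≤ n) (level-horizontal j q p p≢q q≡j)
        (level≤-up d eq 2≤j q≡j 1≤q q≤ (λ _ → q≢f))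
      where
      n = row-neighbour 1≤s 1≤p p≤ topGap-cases
      open RowNeighbour n
      p≢q : even p ≡ not (even q)
      p≢q = trans (sym (not-involutive (even p))) (cong not (sym parity))
      q≡j : even q ≡ even j
      q≡j = trans parity (trans (cong not p≢j) (not-involutive (even j)))

    level≤ : ∀ {j p} → 2 ≤ j → suc j ≤ t → 1 ≤ p → p ≤ lastColumn → (suc j ≡ t → p ≢ topGap) →
             level (cell j p) ≤ N (cell j p)
    level≤ {j} {p} 2≤j j<t 1≤p p≤ exception with same-or-opposite (even p) (even j)
    ... | inj₁ p≡j = level≤-up (t ∸ suc j) (m∸n+n≡m j<t) 2≤j p≡j 1≤p p≤ exception
    ... | inj₂ p≢j = level≤-down (t ∸ suc j) (m∸n+n≡m j<t) 2≤j p≢j 1≤p p≤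

    private
      between⇒≡ : ∀ {k n} → k ≤ n → n ≤ suc k → n ≢ k → n ≡ suc k
      between⇒≡ k≤n n≤ n≢k = ≤-antisym n≤ (≤∧≢⇒< k≤n (n≢k ∘ sym))

      2≤beforeLast : 2 ≤ s + suc s
      2≤beforeLast = +-mono-≤ 1≤s (s≤s z≤n)

      t≡4⇒topGap≡1 : suc 3 ≡ t → topGap ≡ 1
      t≡4⇒topGap≡1 4≡t = topGap-t-even (cong even (sym 4≡t))

      -- For t = 4 the gap is column 1, whose row neighbours are far from the last column.
      t≡4⇒≢lastColumn : suc 3 ≡ t → ∀ {q} → q ≤ suc topGap → q ≢ lastColumn
      t≡4⇒≢lastColumn 4≡t q≤ refl =
        <⇒≱ (≤-trans (n≤1+n 3) (4≤lastColumn 1≤s)) (subst (λ g → lastColumn ≤ suc g) (t≡4⇒topGap≡1 4≡t) q≤)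

    level-above-bottom-corner : N (cell 3 lastColumn) ≡ level (cell 3 lastColumn)
    level-above-bottom-corner = begin
      N (cell 3 lastColumn)      ≡⟨ ≤-antisym (≤-pred (≤∧≢⇒< ≤7-above-bottom-corner (7≢N ∘ sym))) 6≤N ⟩
      6                          ≡⟨ level-opposite-parity 3 lastColumn lastColumn-even ⟨
      level (cell 3 lastColumn)  ∎
      where
      open ≡-Reasoning
      b = cell 3 (s + suc s)
      b-odd : even (s + suc s) ≡ false
      b-odd = trans (cong even (+-suc s s)) (trans (even-suc (s + s)) (cong not (even-double s)))
      adj : Adj s t b (cell 3 lastColumn)
      adj = Adj-row (s≤s (s≤s z≤n)) 3≤t 1≤beforeLast ≤-refl
      Nb≡7 : N b ≡ 7
      Nb≡7 = trans (≤-antisym (≤level ≤-refl 3<t 1≤beforeLast (n≤1+n _) (λ _ → 1+n≢n ∘ sym))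
                              (level≤ (s≤s (s≤s z≤n)) 3<t 1≤beforeLast (n≤1+n _)
                                 (λ 4≡t b≡gap → <⇒≢ 2≤beforeLast (sym (trans b≡gap (t≡4⇒topGap≡1 4≡t))))))
                   (level-same-parity 3 (s + suc s) b-odd)
      7≢N : 7 ≢ N (cell 3 lastColumn)
      7≢N = subst (_≢ N (cell 3 lastColumn)) Nb≡7
              (LevelStep⇒≢ (N-map adj) (subst (¬_ ∘ LoopLevel t) (sym Nb≡7) ¬LoopLevel-7))
      6≤N : 6 ≤ N (cell 3 lastColumn)
      6≤N = ≤-pred (subst (_≤ suc (N (cell 3 lastColumn))) Nb≡7 (≥-across (Adj-sym adj) ≤-refl))

    private
      -- Two steps below the row-t neighbour of the gap, which is at level at least 2t.
      j+j≤N-below-gap : ∀ {j} → 2 ≤ j → suc j ≡ t → j + j ≤ N (cell j topGap)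
      j+j≤N-below-gap {j} 2≤j refl =
        ≤-pred (≤-pred (subst (_≤ suc (suc (N (cell j topGap)))) (cong suc (+-suc j j))
          (≤-trans (≥-across Adj-topNeighbour (row-t-high 1≤q q≤ q≢f))
                   (s≤s (≥-across (Adj-column (topGap-parity refl) (≤-trans (s≤s z≤n) 2≤j) (n≤1+n j)
                                              1≤topGap topGap≤lastColumn) ≤-refl)))))
        where open RowNeighbour topNeighbour

      level-beside-gap : ∀ {j} → 3 ≤ j → suc j ≡ t → N (cell j (RowNeighbour.q topNeighbour)) ≡ j + j
      level-beside-gap {j} 3≤j j+1≡t =
        trans (≤-antisym (≤level 3≤j j<t 1≤q q≤
                            (λ j≡3 → t≡4⇒≢lastColumn (trans (cong suc (sym j≡3)) j+1≡t) (neighbour≤suc topNeighbour)))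
                         (level≤ (≤-trans (n≤1+n 2) 3≤j) j<t 1≤q q≤ (λ _ → q≢f)))
              (level-opposite-parity j q (trans parity (cong not (topGap-parity j+1≡t))))
        where
        open RowNeighbour topNeighbour
        j<t = ≤-reflexive j+1≡t

    level-below-top-corner : ∀ {j} → 3 ≤ j → suc j ≡ t → N (cell j topGap) ≡ level (cell j topGap)
    level-below-top-corner {j} 3≤j j+1≡t = begin
      N (cell j topGap)      ≡⟨ between⇒≡ (j+j≤N-below-gap 2≤j j+1≡t) N≤ (j+j≢N ∘ sym) ⟩
      suc (j + j)            ≡⟨ level-same-parity j topGap gap≡j ⟨
      level (cell j topGap)  ∎
      where
      open ≡-Reasoning
      open RowNeighbour topNeighbour
      2≤j = ≤-trans (n≤1+n 2) 3≤j
      gap≡j : even topGap ≡ even j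
      gap≡j = topGap-parity j+1≡t
      N≤ : N (cell j topGap) ≤ suc (j + j)
      N≤ = subst (N (cell j topGap) ≤_) (level-same-parity j topGap gap≡j)
             (≤level 3≤j (≤-reflexive j+1≡t) 1≤topGap topGap≤lastColumn
                (λ j≡3 → t≡4⇒≢lastColumn (trans (cong suc (sym j≡3)) j+1≡t) (n≤1+n _)))
      j+j≢N : j + j ≢ N (cell j topGap)
      j+j≢N = subst (_≢ N (cell j topGap)) (level-beside-gap 3≤j j+1≡t)
                (LevelStep⇒≢ (N-map (Adj-sym (Adj-neighbour 2≤j (≤-trans (n≤1+n j) (≤-reflexive j+1≡t))
                                                            1≤topGap topGap≤lastColumn topNeighbour)))
                             (subst (¬_ ∘ LoopLevel t) (sym (level-beside-gap 3≤j j+1≡t))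
                                    (¬LoopLevel-double (≤-reflexive j+1≡t))))

    private
      level-exact-off-bottom-corner : ∀ {j p} → 3 ≤ j → suc j ≤ t → 1 ≤ p → p ≤ lastColumn →
                                      (j ≡ 3 → p ≢ lastColumn) → N (cell j p) ≡ level (cell j p)
      level-exact-off-bottom-corner {j} {p} 3≤j j<t 1≤p p≤ exception with suc j ≟ t | p ≟ topGap
      ... | yes j+1≡t | yes refl = level-below-top-corner 3≤j j+1≡t
      ... | yes _ | no p≢gap =
        ≤-antisym (≤level 3≤j j<t 1≤p p≤ exception) (level≤ (≤-trans (n≤1+n 2) 3≤j) j<t 1≤p p≤ (λ _ → p≢gap))
      ... | no j+1≢t | _ =
        ≤-antisym (≤level 3≤j j<t 1≤p p≤ exception)
                  (level≤ (≤-trans (n≤1+n 2) 3≤j) j<t 1≤p p≤ (λ j+1≡t → contradiction j+1≡t j+1≢t))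

    level-exact : ∀ {j p} → 3 ≤ j → suc j ≤ t → 1 ≤ p → p ≤ lastColumn → N (cell j p) ≡ level (cell j p)
    level-exact {j} {p} 3≤j j<t 1≤p p≤ with j ≟ 3 | p ≟ lastColumn
    ... | yes refl | yes refl = level-above-bottom-corner
    ... | yes refl | no p≢last = level-exact-off-bottom-corner 3≤j j<t 1≤p p≤ (λ _ → p≢last)
    ... | no j≢3 | _ = level-exact-off-bottom-corner 3≤j j<t 1≤p p≤ (λ j≡3 → contradiction j≡3 j≢3)

    central : ∀ (x : Vertex s t) → 6 ≤ N (proj₁ x) → N (proj₁ x) < t + t → InMiddleRows (proj₁ x) ⊎ Corner (proj₁ x)
    central x 6≤N N<t+t with region x
    ... | bottom-outer q q-odd q≤ refl = contradiction (proj₁ bottom-low q q-odd q≤) (<⇒≱ 6≤N)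
    ... | bottom-inner q 1≤q q≤ refl = contradiction (proj₂ bottom-low q 1≤q q≤) (<⇒≱ 6≤N)
    ... | bottom-corner x≡ = inj₂ (inj₁ x≡)
    ... | middle j p 3≤j j<t 1≤p p≤ x≡ = inj₁ (j , p , 3≤j , j<t , 1≤p , p≤ , x≡)
    ... | top-corner x≡ = inj₂ (inj₂ x≡)
    ... | top-inner q 1≤q q≤ refl = contradiction (proj₂ top-high q 1≤q q≤) (<⇒≱ N<t+t)
    ... | top-outer q q-odd q≤ refl = contradiction (proj₁ top-high q q-odd q≤) (<⇒≱ N<t+t)

-- Relates the level of h x to a level map N whose bottom ladder is at the low end (the
-- level of h x is σ (N x)), and records how h then permutes the middle rows.
record Orientation (s t : ℕ) : Set where
  field
    σ τ          : ℕ → ℕ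
    ⌊σ/2⌋-middle : ∀ {j} p → 3 ≤ j → suc j ≤ t → ⌊ σ (level (cell j p)) /2⌋ ≡ τ j
    τ-injective  : ∀ {i j} → 3 ≤ i → suc i ≤ t → 3 ≤ j → suc j ≤ t → τ i ≡ τ j → i ≡ j
    τ-surjective : ∀ {j} → 3 ≤ j → suc j ≤ t → ∃ λ i → 3 ≤ i × suc i ≤ t × τ i ≡ j
    σ-middle     : ∀ {n} → 6 ≤ σ n → σ n < t + t → 6 ≤ n × n < t + t
    peak         : Vertex s t
    peak-F       : F s t (proj₁ peak)
    σ-peak       : ∀ {n} → σ n ≡ level (proj₁ peak) → t + t < n

module _ {s t : ℕ} where

  private
    topVertex : Σ (Vertex s t) λ x → F s t (proj₁ x) × level (proj₁ x) ≡ suc t + suc t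
    topVertex with even t in t-parity
    ... | true = (u 1 (suc t) , (s≤s z≤n , s≤s z≤n) , inj₂ (t-even , refl))
               , inj₁ ((s≤s z≤n , s≤s z≤n) , inj₂ (inj₂ (t-even , refl))) , level-eq
      where
      t-even = even⇒Even t t-parity
      level-eq : level (u 1 (suc t)) ≡ suc t + suc t
      level-eq rewrite even-suc t | t-parity = refl
    ... | false = (v 1 (suc t) , (s≤s z≤n , s≤s z≤n) , inj₂ (t-odd , refl))
                , inj₁ ((s≤s z≤n , s≤s z≤n) , inj₂ (inj₂ (t-odd , refl))) , level-eq
      where
      t-odd = odd⇒Odd t t-parity
      level-eq : level (v 1 (suc t)) ≡ suc t + suc t
      level-eq rewrite even-suc t | t-parity = refl

  upright : Orientation s t
  upright = record
    { σ = id
    ; τ = id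
    ; ⌊σ/2⌋-middle = λ {j} p _ _ → trans (⌊level/2⌋≡row (cell j p)) (row-cell j p)
    ; τ-injective = λ _ _ _ _ i≡j → i≡j
    ; τ-surjective = λ {j} 3≤j j<t → j , 3≤j , j<t , refl
    ; σ-middle = λ 6≤n n<t+t → 6≤n , n<t+t
    ; peak = proj₁ topVertex
    ; peak-F = proj₁ (proj₂ topVertex)
    ; σ-peak = λ n≡ →
        subst (t + t <_) (sym (trans n≡ (proj₂ (proj₂ topVertex)))) (s≤s (+-monoʳ-≤ t (n≤1+n t)))
    }

  private
    reflect : ℕ → ℕ
    reflect j = (t ∸ j) + 2

    reflect-middle : ∀ {j} → 3 ≤ j → suc j ≤ t → 3 ≤ reflect j × suc (reflect j) ≤ t
    reflect-middle {j} 3≤j j<t =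
      +-monoˡ-≤ 2 (m<n⇒0<n∸m j<t) ,
      ≤-trans (≤-reflexive (sym (+-suc (t ∸ j) 2)))
        (≤-trans (+-monoʳ-≤ (t ∸ j) 3≤j) (≤-reflexive (m∸n+n≡m (≤-trans (n≤1+n j) j<t))))

    reflect-involutive : ∀ {j} → 3 ≤ j → suc j ≤ t → reflect (reflect j) ≡ j
    reflect-involutive {j} 3≤j j<t = begin
      (t ∸ (d + 2)) + 2            ≡⟨ cong (λ n → (n ∸ (d + 2)) + 2) t≡ ⟨
      (d + (k + 2)) ∸ (d + 2) + 2  ≡⟨ cong (_+ 2) ([m+n]∸[m+o]≡n∸o d (k + 2) 2) ⟩
      (k + 2) ∸ 2 + 2              ≡⟨ cong (_+ 2) (m+n∸n≡m k 2) ⟩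
      k + 2                        ≡⟨ m∸n+n≡m 2≤j ⟩
      j                            ∎
      where
      open ≡-Reasoning
      k = j ∸ 2
      d = t ∸ j
      2≤j : 2 ≤ j
      2≤j = ≤-trans (n≤1+n 2) 3≤j
      t≡ : d + (k + 2) ≡ t
      t≡ = trans (cong (d +_) (m∸n+n≡m 2≤j)) (m∸n+n≡m (≤-trans (n≤1+n j) j<t))

  flipped : 1 ≤ t → Orientation s t
  flipped 1≤t = record
    { σ = flipLevel t
    ; τ = reflect
    ; ⌊σ/2⌋-middle = λ p 3≤j j<t → ⌊flipLevel/2⌋ _ p (≤-trans (n≤1+n _) j<t)
    ; τ-injective = λ {i} {j} 3≤i i<t 3≤j j<t τi≡τj →
        trans (sym (reflect-involutive 3≤i i<t)) (trans (cong reflect τi≡τj) (reflect-involutive 3≤j j<t))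
    ; τ-surjective = λ {j} 3≤j j<t →
        reflect j , proj₁ (reflect-middle 3≤j j<t) , proj₂ (reflect-middle 3≤j j<t) , reflect-involutive 3≤j j<t
    ; σ-middle = λ {n} 6≤σn σn<t+t →
        (≰⇒> λ n≤5 → <⇒≱ σn<t+t (t+t≤flipLevel {t} n≤5)) ,
        (≰⇒> λ t+t≤n → <⇒≱ 6≤σn (flipLevel-≤5 {t} t+t≤n))
    ; peak = v 1 1 , (s≤s z≤n , s≤s z≤n) , inj₁ (s≤s z≤n , 1≤t)
    ; peak-F = inj₁ ((s≤s z≤n , s≤s z≤n) , inj₁ (s≤s z≤n , s≤s z≤n))
    ; σ-peak = λ σn≡3 → ≰⇒> λ n≤t+t →
        contradiction (≤-trans (5≤flipLevel {t} n≤t+t) (≤-reflexive σn≡3)) λ { (s≤s (s≤s (s≤s ()))) }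
    }

module Covering {s t : ℕ} (1≤s : 1 ≤ s) (3<t : 3 < t)
  (h : Vertex s t → Vertex s t) (endo : IsEndomorphism s t h)
  (F-covered : ∀ (x : Vertex s t) → F s t (proj₁ x) → ∃ λ y → h y ≡ x)
  (o : Orientation s t) {N : Raw → ℕ} (N-map : LevelMap s t N)
  (level≡σN : ∀ (x : Vertex s t) → level (proj₁ (h x)) ≡ Orientation.σ o (N (proj₁ x)))
  (bottom-low : Geometry.BottomSide s t N (_≤ 5)) (top-high : Geometry.TopSide s t N (t + t ≤_)) where

  open Orientation o
  open Geometry s t
  open Bounds 1≤s 3<t N-map bottom-low

  row-of-image : ∀ (x : Vertex s t) {j p} → 3 ≤ j → suc j ≤ t → 1 ≤ p → p ≤ lastColumn →
                 proj₁ x ≡ cell j p → row (proj₁ (h x)) ≡ τ j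
  row-of-image x {j} {p} 3≤j j<t 1≤p p≤ x≡ = begin
    row (proj₁ (h x))           ≡⟨ ⌊level/2⌋≡row (proj₁ (h x)) ⟨
    ⌊ level (proj₁ (h x)) /2⌋   ≡⟨ cong ⌊_/2⌋ (level≡σN x) ⟩
    ⌊ σ (N (proj₁ x)) /2⌋       ≡⟨ cong (λ r → ⌊ σ (N r) /2⌋) x≡ ⟩
    ⌊ σ (N (cell j p)) /2⌋      ≡⟨ cong (λ n → ⌊ σ n /2⌋) (level-exact top-high 3≤j j<t 1≤p p≤) ⟩
    ⌊ σ (level (cell j p)) /2⌋  ≡⟨ ⌊σ/2⌋-middle p 3≤j j<t ⟩
    τ j                         ∎
    where open ≡-Reasoning

  same-image : ∀ {y y′ f f′} → h y ≡ f → h y′ ≡ f′ → proj₁ y ≡ proj₁ y′ → proj₁ f ≡ proj₁ f′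
  same-image hy≡f hy′≡f′ y≡y′ = cong proj₁ (trans (sym hy≡f) (trans (cong h (vertex-≡ y≡y′)) hy′≡f′))

  -- h maps the middle row j onto the middle row j*, moving the column by at most one per step.
  module TargetRow {j* : ℕ} (3≤j* : 3 ≤ j*) (j*<t : suc j* ≤ t) where

    private
      source = τ-surjective 3≤j* j*<t

    j : ℕ
    j = proj₁ source

    private
      3≤j : 3 ≤ j
      3≤j = proj₁ (proj₂ source)
      j<t : suc j ≤ t
      j<t = proj₁ (proj₂ (proj₂ source))
      τj≡j* : τ j ≡ j*
      τj≡j* = proj₂ (proj₂ (proj₂ source))
      2≤j* : 2 ≤ j*
      2≤j* = ≤-trans (n≤1+n 2) 3≤j*
      j*≤t : j* ≤ t
      j*≤t = ≤-trans (n≤1+n j*) j*<t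

    cellVertex : ∀ {p} → 1 ≤ p → p ≤ lastColumn → Vertex s t
    cellVertex {p} 1≤p p≤ = cell j p , isVertex-cell (≤-trans (n≤1+n 2) 3≤j) (≤-trans (n≤1+n j) j<t) 1≤p p≤

    row-image : ∀ {p} (1≤p : 1 ≤ p) (p≤ : p ≤ lastColumn) → row (proj₁ (h (cellVertex 1≤p p≤))) ≡ j*
    row-image 1≤p p≤ = trans (row-of-image (cellVertex 1≤p p≤) 3≤j j<t 1≤p p≤ refl) τj≡j*

    imageColumn : ℕ → ℕ
    imageColumn p = extend 0 (column ∘ proj₁ ∘ h) (cell j p)

    imageColumn-cellVertex : ∀ {p} (1≤p : 1 ≤ p) (p≤ : p ≤ lastColumn) →
                             imageColumn p ≡ column (proj₁ (h (cellVertex 1≤p p≤)))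
    imageColumn-cellVertex 1≤p p≤ = extend-vertex 0 (column ∘ proj₁ ∘ h) (cellVertex 1≤p p≤)

    imageColumn-Near : ∀ p → 1 ≤ p → suc p ≤ lastColumn → Near (imageColumn p) (imageColumn (suc p))
    imageColumn-Near p 1≤p p+1≤ =
      subst₂ Near (sym (imageColumn-cellVertex 1≤p p≤)) (sym (imageColumn-cellVertex (s≤s z≤n) p+1≤))
        (Adj-row⇒Near-column (endo x y (Adj-row (≤-trans (n≤1+n 2) 3≤j) (≤-trans (n≤1+n j) j<t) 1≤p p+1≤))
          (trans (row-image 1≤p p≤) (sym (row-image (s≤s z≤n) p+1≤)))
          (subst (2 ≤_) (sym (row-image 1≤p p≤)) 2≤j*) (subst (_≤ t) (sym (row-image 1≤p p≤)) j*≤t))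
      where
      p≤ = ≤-trans (n≤1+n p) p+1≤
      x = cellVertex 1≤p p≤
      y = cellVertex (s≤s z≤n) p+1≤

    Attained : ℕ → Set
    Attained c = ∃ λ p → 1 ≤ p × p ≤ lastColumn × imageColumn p ≡ c

    -- The level of a vertex f of row j* is in [6, 2t), so a preimage of f lies in a middle row,
    -- hence in row j, unless it is a corner.
    preimage-attained : ∀ (f y : Vertex s t) → row (proj₁ f) ≡ j* → h y ≡ f →
                        Attained (column (proj₁ f)) ⊎ Corner (proj₁ y)
    preimage-attained f y row≡ hy≡f
      with σ-middle (subst (6 ≤_) level≡ 6≤level) (subst (_< t + t) level≡ level<)
      where
      level≡ : level (proj₁ f) ≡ σ (N (proj₁ y))
      level≡ = trans (cong (level ∘ proj₁) (sym hy≡f)) (level≡σN y)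
      bounds = subst (λ r → r + r ≤ level (proj₁ f) × level (proj₁ f) ≤ suc (r + r)) row≡ (level-bounds (proj₁ f))
      6≤level : 6 ≤ level (proj₁ f)
      6≤level = ≤-trans (+-mono-≤ 3≤j* 3≤j*) (proj₁ bounds)
      level< : level (proj₁ f) < t + t
      level< = ≤-trans (s≤s (proj₂ bounds)) (subst (_≤ t + t) (cong suc (+-suc j* j*)) (+-mono-≤ j*<t j*<t))
    ... | 6≤N , N< with central top-high y 6≤N N<
    ...   | inj₂ corner = inj₂ corner
    ...   | inj₁ (r , p , 3≤r , r<t , 1≤p , p≤ , y≡) = inj₁ (p , 1≤p , p≤ , (begin
      imageColumn p                               ≡⟨ imageColumn-cellVertex 1≤p p≤ ⟩
      column (proj₁ (h (cellVertex 1≤p p≤)))      ≡⟨ cong (column ∘ proj₁ ∘ h) cellVertex≡y ⟩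
      column (proj₁ (h y))                        ≡⟨ cong (column ∘ proj₁) hy≡f ⟩
      column (proj₁ f)                            ∎))
      where
      open ≡-Reasoning
      r≡j : r ≡ j
      r≡j = τ-injective 3≤r r<t 3≤j j<t
              (trans (sym (row-of-image y 3≤r r<t 1≤p p≤ y≡))
                     (trans (cong (row ∘ proj₁) hy≡f) (trans row≡ (sym τj≡j*))))
      cellVertex≡y : cellVertex 1≤p p≤ ≡ y
      cellVertex≡y = vertex-≡ (trans (cong (λ r → cell r p) (sym r≡j)) (sym y≡))

    -- Distinct targets have distinct preimages, and there are only two corners.
    attained-among : ∀ (f₁ f₂ f₃ : Vertex s t) →
      proj₁ f₁ ≢ proj₁ f₂ → proj₁ f₁ ≢ proj₁ f₃ → proj₁ f₂ ≢ proj₁ f₃ →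
      row (proj₁ f₁) ≡ j* → row (proj₁ f₂) ≡ j* → row (proj₁ f₃) ≡ j* →
      F s t (proj₁ f₁) → F s t (proj₁ f₂) → F s t (proj₁ f₃) →
      Attained (column (proj₁ f₁)) ⊎ Attained (column (proj₁ f₂)) ⊎ Attained (column (proj₁ f₃))
    attained-among f₁ f₂ f₃ f₁≢f₂ f₁≢f₃ f₂≢f₃ r₁ r₂ r₃ f₁∈F f₂∈F f₃∈F
      with F-covered f₁ f₁∈F | F-covered f₂ f₂∈F | F-covered f₃ f₃∈F
    ... | y₁ , h₁ | y₂ , h₂ | y₃ , h₃
      with preimage-attained f₁ y₁ r₁ h₁ | preimage-attained f₂ y₂ r₂ h₂ | preimage-attained f₃ y₃ r₃ h₃
    ... | inj₁ a | _ | _ = inj₁ a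
    ... | inj₂ _ | inj₁ a | _ = inj₂ (inj₁ a)
    ... | inj₂ _ | inj₂ _ | inj₁ a = inj₂ (inj₂ a)
    ... | inj₂ c₁ | inj₂ c₂ | inj₂ c₃ with corners-collide c₁ c₂ c₃
    ...   | inj₁ y₁≡y₂ = contradiction (same-image h₁ h₂ y₁≡y₂) f₁≢f₂
    ...   | inj₂ (inj₁ y₁≡y₃) = contradiction (same-image h₁ h₃ y₁≡y₃) f₁≢f₃
    ...   | inj₂ (inj₂ y₂≡y₃) = contradiction (same-image h₂ h₃ y₂≡y₃) f₂≢f₃

    private
      1≤j* : 1 ≤ j*
      1≤j* = ≤-trans (s≤s z≤n) 3≤j*

      in-F₂ : 3 ≤ j* × j* < t
      in-F₂ = 3≤j* , j*<t

    left-end : ∃ λ p → 1 ≤ p × p ≤ lastColumn × imageColumn p ≤ 3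
    left-end with attained-among
      (v 1 j* , (s≤s z≤n , s≤s z≤n) , inj₁ (1≤j* , j*≤t))
      (u 1 j* , (s≤s z≤n , s≤s z≤n) , inj₁ (2≤j* , j*≤t))
      (v 2 j* , (s≤s z≤n , s≤s 1≤s) , inj₁ (1≤j* , j*≤t))
      (λ ()) (λ ()) (λ ()) refl refl refl
      (inj₂ (in-F₂ , inj₁ refl)) (inj₂ (in-F₂ , inj₁ refl)) (inj₂ (in-F₂ , inj₂ (inj₁ refl)))
    ... | inj₁ (p , 1≤p , p≤ , g≡) = p , 1≤p , p≤ , ≤-trans (≤-reflexive g≡) (s≤s z≤n)
    ... | inj₂ (inj₁ (p , 1≤p , p≤ , g≡)) = p , 1≤p , p≤ , ≤-trans (≤-reflexive g≡) (s≤s (s≤s z≤n))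
    ... | inj₂ (inj₂ (p , 1≤p , p≤ , g≡)) = p , 1≤p , p≤ , ≤-reflexive g≡

    right-end : ∃ λ p → 1 ≤ p × p ≤ lastColumn × s + s ≤ imageColumn p
    right-end with attained-among
      (u s j* , (1≤s , n≤1+n s) , inj₁ (2≤j* , j*≤t))
      (v (suc s) j* , (s≤s z≤n , ≤-refl) , inj₁ (1≤j* , j*≤t))
      (u (suc s) j* , (s≤s z≤n , ≤-refl) , inj₁ (2≤j* , j*≤t))
      (λ ()) (λ ()) (λ ()) refl refl refl
      (inj₂ (in-F₂ , inj₂ (inj₁ refl))) (inj₂ (in-F₂ , inj₂ (inj₂ refl))) (inj₂ (in-F₂ , inj₂ (inj₂ refl)))
    ... | inj₁ (p , 1≤p , p≤ , g≡) = p , 1≤p , p≤ , ≤-reflexive (sym g≡)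
    ... | inj₂ (inj₁ (p , 1≤p , p≤ , g≡)) = p , 1≤p , p≤ , ≤-trans (+-monoʳ-≤ s (n≤1+n s)) (≤-reflexive (sym g≡))
    ... | inj₂ (inj₂ (p , 1≤p , p≤ , g≡)) =
      p , 1≤p , p≤ , ≤-trans (+-mono-≤ (n≤1+n s) (n≤1+n s)) (≤-reflexive (sym g≡))

    private
      attained-within : ∀ {a b q} → 1 ≤ a → a ≤ b → b ≤ lastColumn →
                        Between (imageColumn a) (imageColumn b) q → Attained q
      attained-within 1≤a a≤b b≤ btw
        with intermediate-value imageColumn a≤b
               (λ k a≤k k<b → imageColumn-Near k (≤-trans 1≤a a≤k) (≤-trans k<b b≤)) btw
      ... | k , a≤k , k≤b , gk≡q = k , ≤-trans 1≤a a≤k , ≤-trans k≤b b≤ , gk≡q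

      attained-between : ∀ {a b q} → 1 ≤ a → a ≤ lastColumn → 1 ≤ b → b ≤ lastColumn →
                         imageColumn a ≤ q → q ≤ imageColumn b → Attained q
      attained-between {a} {b} 1≤a a≤ 1≤b b≤ ga≤q q≤gb with a ≤? b
      ... | yes a≤b = attained-within 1≤a a≤b b≤ (inj₁ (ga≤q , q≤gb))
      ... | no a≰b = attained-within 1≤b (≤-trans (n≤1+n b) (≰⇒> a≰b)) a≤ (inj₂ (ga≤q , q≤gb))

    attained : ∀ {q} → 4 ≤ q → suc q ≤ s + s → Attained q
    attained {q} 4≤q q< with left-end | right-end
    ... | pL , 1≤pL , pL≤ , gL≤3 | pR , 1≤pR , pR≤ , s+s≤gR =
      attained-between 1≤pL pL≤ 1≤pR pR≤ (≤-trans gL≤3 (≤-trans (n≤1+n 3) 4≤q))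
                                         (≤-trans (n≤1+n q) (≤-trans q< s+s≤gR))

  surjective : Surjective h
  surjective z with F-or-interior z
  ... | inj₁ z∈F = F-covered z z∈F
  ... | inj₂ ((3≤j* , j*<t) , 4≤q , q<) with TargetRow.attained 3≤j* j*<t 4≤q q<
  ...   | p , 1≤p , p≤ , g≡ = cellVertex 1≤p p≤ ,
          ≡-position (h (cellVertex 1≤p p≤)) z (row-image 1≤p p≤) (trans (sym (imageColumn-cellVertex 1≤p p≤)) g≡)
    where open TargetRow 3≤j* j*<t

module Frame {s t : ℕ} (1≤s : 1 ≤ s) (3<t : 3 < t)
  (h : Vertex s t → Vertex s t) (endo : IsEndomorphism s t h)
  (F-covered : ∀ (x : Vertex s t) → F s t (proj₁ x) → ∃ λ y → h y ≡ x) where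

  open Geometry s t

  private
    1≤t : 1 ≤ t
    1≤t = ≤-trans (s≤s z≤n) 3<t

  imageLevel : Raw → ℕ
  imageLevel = extend 0 (level ∘ proj₁ ∘ h)

  imageLevel-vertex : ∀ (x : Vertex s t) → imageLevel (proj₁ x) ≡ level (proj₁ (h x))
  imageLevel-vertex = extend-vertex 0 (level ∘ proj₁ ∘ h)

  imageLevel-map : LevelMap s t imageLevel
  imageLevel-map {a} {b} adj with Adj⇒IsVertex 1≤t adj
  ... | a-vertex , b-vertex =
    subst₂ (LevelStep t) (sym (imageLevel-vertex (a , a-vertex))) (sym (imageLevel-vertex (b , b-vertex)))
      (level-Adj (endo (a , a-vertex) (b , b-vertex) adj))

  imageLevel-≤ : ∀ r → imageLevel r ≤ suc t + suc t
  imageLevel-≤ = extend-≤ (level ∘ proj₁ ∘ h) z≤n (level-range ∘ h)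

  flipLevel-map : LevelMap s t (flipLevel t ∘ imageLevel)
  flipLevel-map {a} {b} adj = flipLevel-LevelStep (imageLevel-≤ a) (imageLevel-≤ b) (imageLevel-map adj)

  oriented : (o : Orientation s t) {N : Raw → ℕ} → LevelMap s t N →
             (∀ (x : Vertex s t) → level (proj₁ (h x)) ≡ Orientation.σ o (N (proj₁ x))) →
             BottomSide N (_≤ 5) → Surjective h
  oriented o {N} N-map level≡σN bottom-low with Sides.top-low-or-high 1≤s 3<t N-map
  ... | inj₁ top-low = ⊥-elim (<⇒≱ (σ-peak (trans (sym (level≡σN y)) (cong (level ∘ proj₁) hy≡peak)))
                                     (Bounds.≤t+t-everywhere 1≤s 3<t N-map bottom-low top-low y))
    where
    open Orientation o
    y = proj₁ (F-covered peak peak-F)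
    hy≡peak = proj₂ (F-covered peak peak-F)
  ... | inj₂ top-high = Covering.surjective 1≤s 3<t h endo F-covered o N-map level≡σN bottom-low top-high

  surjective : Surjective h
  surjective with Sides.bottom-low-or-high 1≤s 3<t imageLevel-map
  ... | inj₁ low = oriented upright imageLevel-map (sym ∘ imageLevel-vertex) low
  ... | inj₂ (outer-high , inner-high) =
    oriented (flipped 1≤t) flipLevel-map
      (λ x → sym (trans (flipLevel-involutive (imageLevel-≤ (proj₁ x))) (imageLevel-vertex x)))
      ((λ q q-odd q≤ → flipLevel-≤5 {t} (outer-high q q-odd q≤)) ,
       (λ q 1≤q q≤ → flipLevel-≤5 {t} (inner-high q 1≤q q≤)))

lemma5p16 : (s t : ℕ) → 2 < s → 3 < t → IsFrame s t (F s t)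
lemma5p16 s t 2<s 3<t h endo F-covered = Frame.surjective (≤-trans (s≤s z≤n) 2<s) 3<t h endo F-covered
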